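{- Let $\alpha\in\mathcal{L}_{\mathrm{int}}$ and $\beta\in\mathcal{L}_{\mathrm{prop}}$ be such that $\alpha\land\beta$ is propositionally consistent. Then it is undecidable, given a causal simulation model $(\mathsf{T},\mathbf{x})$, whether $(\mathsf{T},\mathbf{x})\models\langle\alpha\rangle\beta$.
   Context: Fix propositional atoms $X_1,X_2,\dots$. $\mathcal{L}_{\mathrm{prop}}$ is the set of propositional formulas over them. $\mathcal{L}_{\mathrm{int}}\subset\mathcal{L}_{\mathrm{prop}}$ consists of $\top$ and all formulas $l_{i_1}\land\dots\land l_{i_n}$ with $i_1<\dots<i_n$, each $l_{i_j}$ being $X_{i_j}$ or $\lnot X_{i_j}$. A causal simulation model is a pair $(\mathsf{T},\mathbf{x})$ where $\mathsf{T}$ is a (possibly non-deterministic) Turing machine whose tape consists of binary variables $X_1,X_2,\dots$, and $\mathbf{x}$ assigns a value in $\{0,1\}$ to each tape variable, only finitely many nonzero. For $\alpha\in\mathcal{L}_{\mathrm{int}}$, the intervention $\mathcal{I}_\alpha(\mathsf{T})$ first sets each variable occurring in $\alpha$ to the value dictated by its literal ($1$ for $X_i$, $0$ for $\lnot X_i$) and then runs $\mathsf{T}$ ignoring all writes to those variables. $(\mathsf{T},\mathbf{x})\models\langle\alpha\rangle\beta$ iff there exists a halting execution of $\mathcal{I}_\alpha(\mathsf{T})$ on input $\mathbf{x}$ whose resulting tape satisfies $\beta$ (with $X_i$ true iff its value is $1$). -}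

module Defs where

open import Data.Nat using (ℕ; zero; suc; _<_; _≡ᵇ_)
open import Data.Bool using (Bool; true; false; if_then_else_; _∧_; _∨_; not)
open import Data.List using (List; []; _∷_; _++_; replicate; concatMap; length; map)
open import Data.List.Membership.Propositional using (_∈_)
open import Data.List.Relation.Unary.Linked using (Linked)
open import Data.Maybe using (Maybe; just; nothing; is-nothing)
open import Data.Product using (Σ; ∃; _×_; _,_)
open import Relation.Binary.PropositionalEquality using (_≡_)
open import Relation.Binary.Construct.Closure.ReflexiveTransitive using (Star)
open import Relation.Nullary using (¬_)
open import Function.Bundles using (_⇔_)

-- Propositional formulas over atoms X i  (i : ℕ; atom X i is tape cell i)

data Formula : Set where
  var  : ℕ → Formula
  ⊤f   : Formula
  ⊥f   : Formula
  ¬f_  : Formula → Formula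
  _∧f_ : Formula → Formula → Formula
  _∨f_ : Formula → Formula → Formula
  _⇒f_ : Formula → Formula → Formula

Valuation : Set
Valuation = ℕ → Bool

eval : Valuation → Formula → Bool
eval v (var i)  = v i
eval v ⊤f       = true
eval v ⊥f       = false
eval v (¬f φ)   = not (eval v φ)
eval v (φ ∧f ψ) = eval v φ ∧ eval v ψ
eval v (φ ∨f ψ) = eval v φ ∨ eval v ψ
eval v (φ ⇒f ψ) = not (eval v φ) ∨ eval v ψ

Consistent : Formula → Set
Consistent φ = ∃ λ (v : Valuation) → eval v φ ≡ true

-- L_int : ⊤ or conjunctions of literals with strictly increasing indices

record Literal : Set where
  constructor lit
  field
    index : ℕ
    value : Bool
open Literal public

litFormula : Literal → Formula
litFormula (lit i true)  = var i
litFormula (lit i false) = ¬f var i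

_<ₗ_ : Literal → Literal → Set
l <ₗ l' = index l < index l'

record Lint : Set where
  constructor mkLint
  field
    lits   : List Literal
    sorted : Linked _<ₗ_ lits
open Lint public

litsFormula : List Literal → Formula
litsFormula []           = ⊤f
litsFormula (l ∷ [])     = litFormula l
litsFormula (l ∷ l' ∷ ls) = litFormula l ∧f litsFormula (l' ∷ ls)

⌜_⌝ : Lint → Formula
⌜ α ⌝ = litsFormula (lits α)

forced : List Literal → ℕ → Maybe Bool
forced []       i = nothing
forced (l ∷ ls) i = if index l ≡ᵇ i then just (value l) else forced ls i

-- (Possibly non-deterministic) Turing machines on a one-way infinite
-- binary tape X 0, X 1, ...; states are naturals, start state 0,
-- head starts on cell 0; a configuration is halted when no transition
-- applies.

data Move : Set where
  L R : Move

record Transition : Set where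
  constructor tr
  field
    from  : ℕ
    read  : Bool
    to    : ℕ
    write : Bool
    move  : Move
open Transition public

record TM : Set where
  constructor mkTM
  field
    transitions : List Transition
open TM public

Deterministic : TM → Set
Deterministic T = ∀ {t t'} → t ∈ transitions T → t' ∈ transitions T →
  from t ≡ from t' → read t ≡ read t' → t ≡ t'

Tape : Set
Tape = ℕ → Bool

record Config : Set where
  constructor cfg
  field
    state : ℕ
    head  : ℕ
    tape  : Tape
open Config public

moveHead : Move → ℕ → ℕ
moveHead L zero    = zero
moveHead L (suc n) = n
moveHead R n       = suc n

-- write b at position h, except on intervened (frozen) cells
writeTape : (ℕ → Maybe Bool) → ℕ → Bool → Tape → Tape
writeTape fr h b t i = if (i ≡ᵇ h) ∧ is-nothing (fr i) then b else t i

data Step (T : TM) (fr : ℕ → Maybe Bool) : Config → Config → Set where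
  step : ∀ {t c} → t ∈ transitions T → from t ≡ state c → read t ≡ tape c (head c) →
         Step T fr c (cfg (to t) (moveHead (move t) (head c)) (writeTape fr (head c) (write t) (tape c)))

Halted : TM → Config → Set
Halted T c = ∀ {t} → t ∈ transitions T → ¬ (from t ≡ state c × read t ≡ tape c (head c))

listTape : List Bool → Tape
listTape []       i       = false
listTape (b ∷ bs) zero    = b
listTape (b ∷ bs) (suc i) = listTape bs i

record Model : Set where
  constructor model
  field
    machine : TM
    input   : List Bool
open Model public

interveneTape : List Literal → Tape → Tape
interveneTape ls t i with forced ls i
... | just b  = b
... | nothing = t i

_⊨⟨_⟩_ : Model → Lint → Formula → Set
M ⊨⟨ α ⟩ β = ∃ λ (c : Config) →
  Star (Step (machine M) (forced (lits α)))
       (cfg 0 0 (interveneTape (lits α) (listTape (input M)))) c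
  × Halted (machine M) c × eval (tape c) β ≡ true

-- Encoding of models as binary strings: a list of naturals n₁ … n_k is
-- written 1^(n₁+1) 0 1^(n₂+1) 0 …  (end of list = a 0 where a number
-- would start, which the zero-filled tape supplies automatically).

encNats : List ℕ → List Bool
encNats = concatMap (λ n → replicate (suc n) true ++ (false ∷ []))

bitℕ : Bool → ℕ
bitℕ false = 0
bitℕ true  = 1

moveℕ : Move → ℕ
moveℕ L = 0
moveℕ R = 1

transℕ : Transition → List ℕ
transℕ (tr q b q' b' m) = q ∷ bitℕ b ∷ q' ∷ bitℕ b' ∷ moveℕ m ∷ []

encModel : Model → List Bool
encModel (model T x) = encNats
  (length (transitions T) ∷ concatMap transℕ (transitions T) ++
   length x ∷ map bitℕ x)

DecidesModels : TM → (Model → Set) → Set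
DecidesModels D P = ∀ (M : Model) → ∃ λ (c : Config) →
  Star (Step D (λ _ → nothing)) (cfg 0 0 (listTape (encModel M))) c
  × Halted D c × (tape c 0 ≡ true ⇔ P M)

TuringDecidable : (Model → Set) → Set
TuringDecidable P = ∃ λ (D : TM) → Deterministic D × DecidesModels D P

module Submission where

-- A diagonal argument run inside the model of computation itself. Fix a valuation v satisfying
-- α ∧ β and suppose a deterministic machine D decides ⟨α⟩β. We build a machine P and an input d
-- listing P's own transition table. Started on the intervened input, P reconstructs from d the
-- encoding of its own model (P , d), simulates D on it and contradicts the answer: on yes it runs
-- forever, so no halting execution exists; on no it writes v on the cells mentioned in α and β
-- and halts, so the model satisfies ⟨α⟩β. No recursion theorem is needed, since the encoding of
-- (P , d) is an explicit function of P's transition table.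

open import Defs
open import Relation.Nullary using (¬_; Dec; yes; no)
open import Data.Nat
open import Data.Nat.Properties
open import Data.Nat.DivMod using (_%_; _/_; [m+kn]%n≡m%n; m<n⇒m%n≡m; +-distrib-/-∣ʳ; m<n⇒m/n≡0; m*n/n≡m)
open import Data.Nat.Divisibility using (n∣m*n)
open import Data.Bool using (Bool; true; false; if_then_else_; _∧_; _∨_; not; T) renaming (_≟_ to _≟B_)
open import Data.List using (List; []; _∷_; _++_; length; map; replicate; concatMap)
import Data.List.Properties as LP
open import Data.List.Membership.Propositional using (_∈_)
open import Data.List.Membership.Propositional.Properties using (∈-++⁺ˡ; ∈-++⁺ʳ; ∈-++⁻)
open import Data.List.Relation.Unary.Any using (here; there)
open import Data.Maybe using (Maybe; just; nothing; is-nothing; _>>=_)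
open import Data.Product using (∃; _×_; _,_; proj₁; proj₂)
open import Data.Sum using (inj₁; inj₂)
open import Data.Empty
open import Data.Unit using (⊤; tt)
open import Relation.Binary.PropositionalEquality
open import Relation.Binary.Construct.Closure.ReflexiveTransitive using (Star; ε; _◅_; _◅◅_)
open import Function.Bundles using (_⇔_; Equivalence)

divMod-injective : ∀ {n k k′ i i′} → k < n → k′ < n → k + i * n ≡ k′ + i′ * n → k ≡ k′ × i ≡ i′
divMod-injective {n@(suc _)} {i = i} {i′} k<n k′<n e =
  trans (sym (remainder {i = i} k<n)) (trans (cong (_% n) e) (remainder {i = i′} k′<n)) ,
  trans (sym (quotient {i = i} k<n)) (trans (cong (_/ n) e) (quotient {i = i′} k′<n))
  where
  remainder : ∀ {k i} → k < n → (k + i * n) % n ≡ k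
  remainder {k} {i} k<n = trans ([m+kn]%n≡m%n k i n) (m<n⇒m%n≡m k<n)
  quotient : ∀ {k i} → k < n → (k + i * n) / n ≡ i
  quotient {k} {i} k<n = trans (+-distrib-/-∣ʳ k (n∣m*n i)) (cong₂ _+_ (m<n⇒m/n≡0 k<n) (m*n/n≡m i n))

≡ᵇ-refl : ∀ n → (n ≡ᵇ n) ≡ true
≡ᵇ-refl zero = refl
≡ᵇ-refl (suc n) = ≡ᵇ-refl n

≡ᵇ-true⇒≡ : ∀ m n → (m ≡ᵇ n) ≡ true → m ≡ n
≡ᵇ-true⇒≡ m n e = ≡ᵇ⇒≡ m n (subst T (sym e) tt)

≢⇒≡ᵇfalse : ∀ {m n} → m ≢ n → (m ≡ᵇ n) ≡ false
≢⇒≡ᵇfalse {m} {n} ne with m ≡ᵇ n in e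
... | false = refl
... | true = ⊥-elim (ne (≡ᵇ-true⇒≡ m n e))

≡⇒≡ᵇ-true : ∀ m n → m ≡ n → (m ≡ᵇ n) ≡ true
≡⇒≡ᵇ-true m .m refl = ≡ᵇ-refl m

not-true : ∀ {b} → not b ≡ true → b ≡ false
not-true {false} _ = refl

∧-elimˡ : ∀ {a b} → a ∧ b ≡ true → a ≡ true
∧-elimˡ {true} _ = refl
∧-elimʳ : ∀ {a b} → a ∧ b ≡ true → b ≡ true
∧-elimʳ {true} e = e

nth : {A : Set} → List A → ℕ → Maybe A
nth [] _ = nothing
nth (x ∷ xs) zero = just x
nth (x ∷ xs) (suc k) = nth xs k

nth-just⇒< : ∀ {A : Set} (xs : List A) {k x} → nth xs k ≡ just x → k < length xs
nth-just⇒< (x ∷ xs) {zero} _ = s≤s z≤n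
nth-just⇒< (x ∷ xs) {suc k} e = s≤s (nth-just⇒< xs e)

nthBit : List Bool → ℕ → Bool
nthBit [] _ = false
nthBit (x ∷ xs) zero = x
nthBit (x ∷ xs) (suc k) = nthBit xs k

replicate-+ : ∀ m n (x : Bool) → replicate (m + n) x ≡ replicate m x ++ replicate n x
replicate-+ zero n x = refl
replicate-+ (suc m) n x = cong (x ∷_) (replicate-+ m n x)

update : {A : Set} → ℕ → A → (ℕ → A) → ℕ → A
update k b g m = if m ≡ᵇ k then b else g m

update-here : ∀ {A : Set} k (b : A) g → update k b g k ≡ b
update-here k b g rewrite ≡ᵇ-refl k = refl

update-there : ∀ {A : Set} k (b : A) g m → m ≢ k → update k b g m ≡ g m
update-there k b g m ne rewrite ≢⇒≡ᵇfalse ne = refl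

encNats-++ : ∀ xs ys → encNats (xs ++ ys) ≡ encNats xs ++ encNats ys
encNats-++ [] ys = refl
encNats-++ (x ∷ xs) ys = trans (cong ((replicate (suc x) true ++ false ∷ []) ++_) (encNats-++ xs ys))
                       (sym (LP.++-assoc (replicate (suc x) true ++ false ∷ []) (encNats xs) (encNats ys)))

listTape-replicate : ∀ n r x → listTape (replicate n false ++ r) (x + n) ≡ listTape r x
listTape-replicate zero r x = cong (listTape r) (+-identityʳ x)
listTape-replicate (suc n) r x = trans (cong (listTape (false ∷ (replicate n false ++ r))) (+-suc x n)) (listTape-replicate n r x)

literalBound : List Literal → ℕ
literalBound [] = 0
literalBound (l ∷ ls) = suc (index l) + literalBound ls

forced-beyond : ∀ ls i → literalBound ls ≤ i → forced ls i ≡ nothing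
forced-beyond [] i _ = refl
forced-beyond (l ∷ ls) i le with index l ≡ᵇ i in e
... | true = ⊥-elim (<⇒≱ (≤-trans (m≤m+n (suc (index l)) (literalBound ls)) le) (≤-reflexive (sym (≡ᵇ-true⇒≡ (index l) i e))))
... | false = forced-beyond ls i (≤-trans (m≤n+m (literalBound ls) (suc (index l))) le)

literal-holds : ∀ v l → eval v (litFormula l) ≡ true → v (index l) ≡ value l
literal-holds v (lit i true) e = e
literal-holds v (lit i false) e with v i
literal-holds v (lit i false) () | true
... | false = refl

forced-agrees-∷ : ∀ v l ls i b → eval v (litsFormula (l ∷ ls)) ≡ true → forced (l ∷ ls) i ≡ just b → v i ≡ b
forced-agrees-∷ v l [] i b ev fe = aux (index l ≡ᵇ i) refl fe
  where
    aux : ∀ c → (index l ≡ᵇ i) ≡ c → (if c then just (value l) else nothing) ≡ just b → v i ≡ b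
    aux true e refl rewrite sym (≡ᵇ-true⇒≡ (index l) i e) = literal-holds v l ev
forced-agrees-∷ v l (l' ∷ ls) i b ev fe = aux (index l ≡ᵇ i) refl fe
  where
    aux : ∀ c → (index l ≡ᵇ i) ≡ c → (if c then just (value l) else forced (l' ∷ ls) i) ≡ just b → v i ≡ b
    aux true e refl rewrite sym (≡ᵇ-true⇒≡ (index l) i e) = literal-holds v l (∧-elimˡ ev)
    aux false e fe' = forced-agrees-∷ v l' ls i b (∧-elimʳ {eval v (litFormula l)} ev) fe'

forced-agrees : ∀ v ls i b → eval v (litsFormula ls) ≡ true → forced ls i ≡ just b → v i ≡ b
forced-agrees v [] i b _ ()
forced-agrees v (l ∷ ls) i b ev fe = forced-agrees-∷ v l ls i b ev fe

varBound : Formula → ℕ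
varBound (var i) = suc i
varBound ⊤f = 0
varBound ⊥f = 0
varBound (¬f φ) = varBound φ
varBound (φ ∧f ψ) = varBound φ + varBound ψ
varBound (φ ∨f ψ) = varBound φ + varBound ψ
varBound (φ ⇒f ψ) = varBound φ + varBound ψ

eval-cong : ∀ (t v : ℕ → Bool) φ → (∀ i → i < varBound φ → t i ≡ v i) → eval t φ ≡ eval v φ
eval-cong t v (var i) h = h i ≤-refl
eval-cong t v ⊤f h = refl
eval-cong t v ⊥f h = refl
eval-cong t v (¬f φ) h = cong not (eval-cong t v φ h)
eval-cong t v (φ ∧f ψ) h = cong₂ _∧_ (eval-cong t v φ (λ i i< → h i (≤-trans i< (m≤m+n _ _)))) (eval-cong t v ψ (λ i i< → h i (≤-trans i< (m≤n+m _ _))))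
eval-cong t v (φ ∨f ψ) h = cong₂ _∨_ (eval-cong t v φ (λ i i< → h i (≤-trans i< (m≤m+n _ _)))) (eval-cong t v ψ (λ i i< → h i (≤-trans i< (m≤n+m _ _))))
eval-cong t v (φ ⇒f ψ) h = cong₂ (λ a b → not a ∨ b) (eval-cong t v φ (λ i i< → h i (≤-trans i< (m≤m+n _ _)))) (eval-cong t v ψ (λ i i< → h i (≤-trans i< (m≤n+m _ _))))

intervene-free : ∀ ls t i → forced ls i ≡ nothing → interveneTape ls t i ≡ t i
intervene-free ls t i e with forced ls i
intervene-free ls t i refl | nothing = refl

intervene-forced : ∀ ls t i b → forced ls i ≡ just b → interveneTape ls t i ≡ b
intervene-forced ls t i b e with forced ls i
intervene-forced ls t i b refl | just _ = refl

write-here : ∀ fr h x t → is-nothing (fr h) ≡ true → writeTape fr h x t h ≡ x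
write-here fr h x t e rewrite ≡ᵇ-refl h | e = refl

write-elsewhere : ∀ fr h x t i → i ≢ h → writeTape fr h x t i ≡ t i
write-elsewhere fr h x t i ne rewrite ≢⇒≡ᵇfalse ne = refl

write-current : ∀ fr h x t → t h ≡ x → writeTape fr h x t ≗ t
write-current fr h x t e i with i ≡ᵇ h in q
... | false = refl
... | true with is-nothing (fr i)
... | false = refl
... | true rewrite ≡ᵇ-true⇒≡ i h q = sym e

write-restore : ∀ fr h h' t z y x → t h ≡ x → is-nothing (fr h) ≡ true → writeTape fr h z t h' ≡ y →
           writeTape fr h x (writeTape fr h' y (writeTape fr h z t)) ≗ t
write-restore fr h h' t z y x e f ey i with i ≟ h
... | yes refl = trans (write-here fr h x (writeTape fr h' y (writeTape fr h z t)) f) (sym e)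
... | no ne = trans (write-elsewhere fr h x (writeTape fr h' y (writeTape fr h z t)) i ne)
                (trans (write-current fr h' y (writeTape fr h z t) ey i) (write-elsewhere fr h z t i ne))

≗-trans : ∀ {a b c : Tape} → a ≗ b → b ≗ c → a ≗ c
≗-trans p q i = trans (p i) (q i)

≗-refl : ∀ {a : Tape} → a ≗ a
≗-refl i = refl

moveHeadN : Move → ℕ → ℕ → ℕ
moveHeadN d zero h = h
moveHeadN d (suc n) h = moveHeadN d n (moveHead d h)

halted⇒¬step : ∀ {M fr c c′} → Step M fr c c′ → Halted M c → ⊥
halted⇒¬step (step t∈ f r) h = h t∈ (f , r)

Respects : (ℕ → Maybe Bool) → Tape → Set
Respects fr t = ∀ i b → fr i ≡ just b → t i ≡ b

write-respects : ∀ fr h x t → Respects fr t → Respects fr (writeTape fr h x t)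
write-respects fr h x t r i b e with i ≡ᵇ h
... | false = r i b e
... | true rewrite e = r i b e

step-respects : ∀ {M fr c c′} → Step M fr c c′ → Respects fr (tape c) → Respects fr (tape c′)
step-respects {fr = fr} {c = c} (step _ _ _) = write-respects fr (head c) _ (tape c)

run-respects : ∀ {M fr c c′} → Star (Step M fr) c c′ → Respects fr (tape c) → Respects fr (tape c′)
run-respects ε r = r
run-respects (s ◅ ss) r = run-respects ss (step-respects s r)

Functional : TM → (ℕ → Maybe Bool) → Set
Functional M fr = ∀ {c c₁ c₂} → Step M fr c c₁ → Step M fr c c₂ → c₁ ≡ c₂

functional-run-prefix : ∀ {M fr} → Functional M fr → ∀ {c₀ c d} → Star (Step M fr) c₀ c → Halted M c →
                        Star (Step M fr) c₀ d → Star (Step M fr) d c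
functional-run-prefix sf r h ε = r
functional-run-prefix sf ε h (s ◅ ss) = ⊥-elim (halted⇒¬step s h)
functional-run-prefix sf (s ◅ r) h (s′ ◅ ss) with sf s s′
... | refl = functional-run-prefix sf r h ss

lookupTransition : List Transition → ℕ → Bool → Maybe Transition
lookupTransition [] q b = nothing
lookupTransition (t ∷ ts) q b with from t ≟ q | read t ≟B b
... | yes _ | yes _ = just t
... | _ | _ = lookupTransition ts q b

lookupTransition-sound : ∀ ts q b t → lookupTransition ts q b ≡ just t → t ∈ ts × from t ≡ q × read t ≡ b
lookupTransition-sound (t' ∷ ts) q b t e with from t' ≟ q | read t' ≟B b
lookupTransition-sound (t' ∷ ts) q b t refl | yes p | yes p' = here refl , p , p'
... | yes _ | no _ with lookupTransition-sound ts q b t e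
... | a , c , d = there a , c , d
lookupTransition-sound (t' ∷ ts) q b t e | no _ | _ with lookupTransition-sound ts q b t e
... | a , c , d = there a , c , d

lookupTransition-none : ∀ ts q b → (∀ {t} → t ∈ ts → ¬ (from t ≡ q × read t ≡ b)) → lookupTransition ts q b ≡ nothing
lookupTransition-none [] q b h = refl
lookupTransition-none (t' ∷ ts) q b h with from t' ≟ q | read t' ≟B b
... | yes p | yes p' = ⊥-elim (h (here refl) (p , p'))
... | yes _ | no _ = lookupTransition-none ts q b (λ t∈ → h (there t∈))
... | no _ | _ = lookupTransition-none ts q b (λ t∈ → h (there t∈))

lookupTransition-complete : ∀ ts q b t → t ∈ ts → from t ≡ q → read t ≡ b → ∃ λ t' → lookupTransition ts q b ≡ just t'
lookupTransition-complete ts q b t t∈ f r with lookupTransition ts q b in e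
... | just t' = t' , refl
... | nothing = ⊥-elim (go ts e t∈)
  where go : ∀ ts → lookupTransition ts q b ≡ nothing → t ∈ ts → ⊥
        go (t'' ∷ ts) e (here refl) with from t'' ≟ q | read t'' ≟B b
        go (t'' ∷ ts) () (here refl) | yes _ | yes _
        ... | yes _ | no ¬r = ¬r r
        ... | no nf | _ = nf f
        go (t'' ∷ ts) e (there t∈) with from t'' ≟ q | read t'' ≟B b
        go (t'' ∷ ts) () (there t∈) | yes _ | yes _
        ... | yes _ | no _ = go ts e t∈
        ... | no _ | _ = go ts e t∈

sumTargets : List Transition → ℕ
sumTargets [] = 0
sumTargets (t ∷ ts) = to t + sumTargets ts

to≤sumTargets : ∀ ts t → t ∈ ts → to t ≤ sumTargets ts
to≤sumTargets (t' ∷ ts) t (here refl) = m≤m+n (to t) (sumTargets ts)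
to≤sumTargets (t' ∷ ts) t (there t∈) = ≤-trans (to≤sumTargets ts t t∈) (m≤n+m (sumTargets ts) (to t'))

-- A machine given by a finite transition table on states (g , i), where the tag g says what the
-- machine is doing and the parameter i < paramBound is a counter; (g , i) is the natural number
-- tagIndex g + i * tagCount.
module TableMachine (Tag : Set) (tags : List Tag) (tagIndex : Tag → ℕ)
                    (nth-tagIndex : ∀ g → nth tags (tagIndex g) ≡ just g)
                    (paramBound : ℕ) (δ : Tag → ℕ → Bool → Maybe (Tag × ℕ × Bool × Move)) where

  tagCount : ℕ
  tagCount = length tags

  tagIndex<tagCount : ∀ g → tagIndex g < tagCount
  tagIndex<tagCount g = nth-just⇒< tags (nth-tagIndex g)

  stateCode : Tag → ℕ → ℕ
  stateCode g i = tagIndex g + i * tagCount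

  δℕ : ℕ → ℕ → Bool → Maybe (Tag × ℕ × Bool × Move)
  δℕ k i b = nth tags k >>= λ g → δ g i b

  δℕ-tagIndex : ∀ g i b → δℕ (tagIndex g) i b ≡ δ g i b
  δℕ-tagIndex g i b = cong (λ m → m >>= λ g → δ g i b) (nth-tagIndex g)

  abstract
    entry : ℕ → ℕ → Bool → List Transition
    entry k i b with δℕ k i b
    ... | nothing = []
    ... | just (g' , i' , b' , m) = tr (k + i * tagCount) b (stateCode g' i') b' m ∷ []

    column : ℕ → ℕ → List Transition
    column zero i = []
    column (suc k) i = entry k i false ++ (entry k i true ++ column k i)

    table : ℕ → List Transition
    table zero = []
    table (suc i) = column tagCount i ++ table i

    entry-out : ∀ {k i b t} → t ∈ entry k i b → ∃ λ g' → ∃ λ i' → ∃ λ b' → ∃ λ m →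
              δℕ k i b ≡ just (g' , i' , b' , m) × t ≡ tr (k + i * tagCount) b (stateCode g' i') b' m
    entry-out {k} {i} {b} t∈ with δℕ k i b | t∈
    ... | just (g' , i' , b' , m) | here refl = g' , i' , b' , m , refl , refl

    entry-in : ∀ {k i b g' i' b' m} → δℕ k i b ≡ just (g' , i' , b' , m) →
             tr (k + i * tagCount) b (stateCode g' i') b' m ∈ entry k i b
    entry-in {k} {i} {b} e with δℕ k i b
    entry-in refl | just _ = here refl

    column-out : ∀ {K i t} → t ∈ column K i → ∃ λ k → ∃ λ b → k < K × t ∈ entry k i b
    column-out {suc K} {i} t∈ with ∈-++⁻ (entry K i false) t∈
    ... | inj₁ x = K , false , ≤-refl , x
    ... | inj₂ y with ∈-++⁻ (entry K i true) y
    ... | inj₁ x = K , true , ≤-refl , x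
    ... | inj₂ z with column-out {K} z
    ... | k , b , k< , w = k , b , m≤n⇒m≤1+n k< , w

    column-in : ∀ {K i t k b} → k < K → t ∈ entry k i b → t ∈ column K i
    column-in {suc K} {i} {t} {k} {b} k< t∈ with k ≟ K
    column-in {suc K} {i} {t} {k} {false} k< t∈ | yes refl = ∈-++⁺ˡ t∈
    column-in {suc K} {i} {t} {k} {true} k< t∈ | yes refl = ∈-++⁺ʳ (entry K i false) (∈-++⁺ˡ t∈)
    ... | no k≢K = ∈-++⁺ʳ (entry K i false) (∈-++⁺ʳ (entry K i true)
                      (column-in (≤∧≢⇒< (≤-pred k<) k≢K) t∈))

    table-out : ∀ {I t} → t ∈ table I → ∃ λ k → ∃ λ i → ∃ λ b → k < tagCount × i < I × t ∈ entry k i b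
    table-out {suc I} t∈ with ∈-++⁻ (column tagCount I) t∈
    ... | inj₁ x with column-out x
    ... | k , b , k< , w = k , I , b , k< , ≤-refl , w
    table-out {suc I} t∈ | inj₂ y with table-out {I} y
    ... | k , i , b , k< , i< , w = k , i , b , k< , m≤n⇒m≤1+n i< , w

    table-in : ∀ {I t k i b} → k < tagCount → i < I → t ∈ entry k i b → t ∈ table I
    table-in {suc I} {t} {k} {i} k< i< t∈ with i ≟ I
    ... | yes refl = ∈-++⁺ˡ (column-in k< t∈)
    ... | no i≢I = ∈-++⁺ʳ (column tagCount I) (table-in k< (≤∧≢⇒< (≤-pred i<) i≢I) t∈)


  tableMachine : TM
  tableMachine = mkTM (table paramBound)

  table-step : ∀ {fr c g i b g' i' b' m} → i < paramBound → state c ≡ stateCode g i → tape c (head c) ≡ b →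
          δ g i b ≡ just (g' , i' , b' , m) →
          Step tableMachine fr c (cfg (stateCode g' i') (moveHead m (head c)) (writeTape fr (head c) b' (tape c)))
  table-step {fr} {c} {g} {i} {b} {g'} {i'} {b'} {m} i< st rd e =
    step {t = tr (stateCode g i) b (stateCode g' i') b' m}
         (table-in (tagIndex<tagCount g) i< (entry-in (trans (δℕ-tagIndex g i b) e))) (sym st) (sym rd)

  table-halted : ∀ {c g i} → state c ≡ stateCode g i → (∀ b → δ g i b ≡ nothing) → Halted tableMachine c
  table-halted {c} {g} {i} st hn {t} t∈ (f , r) with table-out {paramBound} t∈
  ... | k , i₁ , b , k< , i< , w with entry-out w
  ... | g' , i' , b' , m , e , refl with divMod-injective {k = k} {tagIndex g} {i₁} {i} k< (tagIndex<tagCount g) (trans f st)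
  ... | refl , refl = case (trans (sym e) (trans (δℕ-tagIndex g i b) (hn b)))
    where case : just (g' , i' , b' , m) ≡ nothing → ⊥
          case ()

  table-functional : ∀ {fr} → Functional tableMachine fr
  table-functional (step {t₁} t∈₁ f₁ r₁) (step {t₂} t∈₂ f₂ r₂) with table-out {paramBound} t∈₁ | table-out {paramBound} t∈₂
  ... | k₁ , i₁ , b₁ , k<₁ , _ , w₁ | k₂ , i₂ , b₂ , k<₂ , _ , w₂ with entry-out w₁ | entry-out w₂
  ... | g₁ , j₁ , c₁ , m₁ , e₁ , refl | g₂ , j₂ , c₂ , m₂ , e₂ , refl
    with divMod-injective {k = k₁} {k₂} {i₁} {i₂} k<₁ k<₂ (trans f₁ (sym f₂)) | trans r₁ (sym r₂)
  ... | refl , refl | refl with trans (sym e₁) e₂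
  ... | refl = refl

record Block : Set where
  constructor block
  field mark flag datum : Bool
open Block public

data Slot : Set where j0 j1 j2 : Slot

slotIndex : Slot → ℕ
slotIndex j0 = 0
slotIndex j1 = 1
slotIndex j2 = 2

slotIndex<3 : ∀ j → slotIndex j < 3
slotIndex<3 j0 = s≤s z≤n
slotIndex<3 j1 = s≤s (s≤s z≤n)
slotIndex<3 j2 = s≤s (s≤s (s≤s z≤n))

slotIndex-injective : ∀ {j j'} → slotIndex j ≡ slotIndex j' → j ≡ j'
slotIndex-injective {j0} {j0} e = refl
slotIndex-injective {j1} {j1} e = refl
slotIndex-injective {j2} {j2} e = refl
slotIndex-injective {j0} {j1} ()
slotIndex-injective {j0} {j2} ()
slotIndex-injective {j1} {j0} ()
slotIndex-injective {j1} {j2} ()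
slotIndex-injective {j2} {j0} ()
slotIndex-injective {j2} {j1} ()

_≟ˢ_ : (a b : Slot) → Dec (a ≡ b)
a ≟ˢ b with slotIndex a ≟ slotIndex b
... | yes e = yes (slotIndex-injective e)
... | no ne = no (λ e → ne (cong slotIndex e))

readSlot : Slot → Block → Bool
readSlot j0 b = mark b
readSlot j1 b = flag b
readSlot j2 b = datum b

writeSlot : Slot → Bool → Block → Block
writeSlot j0 x (block m f v) = block x f v
writeSlot j1 x (block m f v) = block m x v
writeSlot j2 x (block m f v) = block m f x

readSlot-writeSlot : ∀ j x b → readSlot j (writeSlot j x b) ≡ x
readSlot-writeSlot j0 x (block m f v) = refl
readSlot-writeSlot j1 x (block m f v) = refl
readSlot-writeSlot j2 x (block m f v) = refl

readSlot-writeSlot-other : ∀ j j' x b → j' ≢ j → readSlot j' (writeSlot j x b) ≡ readSlot j' b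
readSlot-writeSlot-other j0 j0 x b ne = ⊥-elim (ne refl)
readSlot-writeSlot-other j0 j1 x (block m f v) ne = refl
readSlot-writeSlot-other j0 j2 x (block m f v) ne = refl
readSlot-writeSlot-other j1 j0 x (block m f v) ne = refl
readSlot-writeSlot-other j1 j1 x b ne = ⊥-elim (ne refl)
readSlot-writeSlot-other j1 j2 x (block m f v) ne = refl
readSlot-writeSlot-other j2 j0 x (block m f v) ne = refl
readSlot-writeSlot-other j2 j1 x (block m f v) ne = refl
readSlot-writeSlot-other j2 j2 x b ne = ⊥-elim (ne refl)

blank : Block
blank = block false false false

blockAt : List Block → ℕ → Block
blockAt [] _ = blank
blockAt (x ∷ xs) zero = x
blockAt (x ∷ xs) (suc k) = blockAt xs k

AllBlocks : (Block → Bool) → List Block → Set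
AllBlocks p [] = ⊤
AllBlocks p (x ∷ xs) = p x ≡ true × AllBlocks p xs

blockAt-++ : ∀ pre ys i → blockAt (pre ++ ys) (length pre + i) ≡ blockAt ys i
blockAt-++ [] ys i = refl
blockAt-++ (x ∷ pre) ys i = blockAt-++ pre ys i

blockAt-++-AllBlocks : ∀ p xs ys → AllBlocks p xs → ∀ i → i < length xs → p (blockAt (xs ++ ys) i) ≡ true
blockAt-++-AllBlocks p (x ∷ xs) ys (px , _) zero _ = px
blockAt-++-AllBlocks p (x ∷ xs) ys (_ , pxs) (suc i) (s≤s i<) = blockAt-++-AllBlocks p xs ys pxs i i<

blockAt-beyond : ∀ xs i → blockAt xs (length xs + i) ≡ blank
blockAt-beyond [] i = refl
blockAt-beyond (x ∷ xs) i = blockAt-beyond xs i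

AllBlocks-++ : ∀ p xs ys → AllBlocks p xs → AllBlocks p ys → AllBlocks p (xs ++ ys)
AllBlocks-++ p [] ys _ q = q
AllBlocks-++ p (x ∷ xs) ys (a , b) q = a , AllBlocks-++ p xs ys b q

AllBlocks-map : ∀ {A : Set} p (f : A → Block) xs → (∀ a → p (f a) ≡ true) → AllBlocks p (map f xs)
AllBlocks-map p f [] h = tt
AllBlocks-map p f (x ∷ xs) h = h x , AllBlocks-map p f xs h

update-middle : ∀ xs b b' ys g → (∀ m → g m ≡ blockAt (xs ++ b ∷ ys) m) → ∀ m → update (length xs) b' g m ≡ blockAt (xs ++ b' ∷ ys) m
update-middle xs b b' ys g e m with m ≟ length xs
... | yes refl rewrite ≡ᵇ-refl (length xs) = sym (trans (cong (blockAt (xs ++ b' ∷ ys)) (sym (+-identityʳ _))) (blockAt-++ xs (b' ∷ ys) 0))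
... | no ne rewrite ≢⇒≡ᵇfalse ne = trans (e m) (go xs m ne)
  where go : ∀ xs m → m ≢ length xs → blockAt (xs ++ b ∷ ys) m ≡ blockAt (xs ++ b' ∷ ys) m
        go [] zero ne = ⊥-elim (ne refl)
        go [] (suc m) ne = refl
        go (x ∷ xs) zero ne = refl
        go (x ∷ xs) (suc m) ne = go xs m (λ z → ne (cong suc z))

update-snoc : ∀ bs b g → (∀ m → g m ≡ blockAt bs m) → ∀ m → update (length bs) b g m ≡ blockAt (bs ++ b ∷ []) m
update-snoc bs b g e m with m ≟ length bs
... | yes refl rewrite ≡ᵇ-refl (length bs) = sym (trans (cong (blockAt (bs ++ b ∷ [])) (sym (+-identityʳ _))) (blockAt-++ bs (b ∷ []) 0))
... | no ne rewrite ≢⇒≡ᵇfalse ne = trans (e m) (go bs m ne)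
  where go : ∀ bs m → m ≢ length bs → blockAt bs m ≡ blockAt (bs ++ b ∷ []) m
        go [] zero ne = ⊥-elim (ne refl)
        go [] (suc m) ne = refl
        go (x ∷ xs) zero ne = refl
        go (x ∷ xs) (suc m) ne = go xs m (λ z → ne (cong suc z))

lastBlock : Block → List Block → Block
lastBlock x [] = x
lastBlock x (y ∷ ys) = lastBlock y ys

blockAt-last : ∀ x xs rest → blockAt (x ∷ (xs ++ rest)) (length xs) ≡ lastBlock x xs
blockAt-last x [] rest = refl
blockAt-last x (y ∷ xs) rest = blockAt-last y xs rest

blockAt-AllBlocks : ∀ p xs → AllBlocks p xs → ∀ i → i < length xs → p (blockAt xs i) ≡ true
blockAt-AllBlocks p (x ∷ xs) (px , _) zero _ = px
blockAt-AllBlocks p (x ∷ xs) (_ , q) (suc i) (s≤s i<) = blockAt-AllBlocks p xs q i i<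

Unread Read : Bool → Block
Unread a = block false true a
Read a = block true true a

sentinel : Block
sentinel = block false false true

nonBlank : Block → Bool
nonBlank b = mark b ∨ flag b

flatten : List Block → List Bool
flatten [] = []
flatten (block m f v ∷ bs) = m ∷ f ∷ v ∷ flatten bs

listTape-flatten : ∀ bs k j → listTape (flatten bs) (slotIndex j + k * 3) ≡ readSlot j (blockAt bs k)
listTape-flatten [] zero j0 = refl
listTape-flatten [] zero j1 = refl
listTape-flatten [] zero j2 = refl
listTape-flatten [] (suc k) j0 = refl
listTape-flatten [] (suc k) j1 = refl
listTape-flatten [] (suc k) j2 = refl
listTape-flatten (block m f v ∷ bs) zero j0 = refl
listTape-flatten (block m f v ∷ bs) zero j1 = refl
listTape-flatten (block m f v ∷ bs) zero j2 = refl
listTape-flatten (block m f v ∷ bs) (suc k) j0 = listTape-flatten bs k j0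
listTape-flatten (block m f v ∷ bs) (suc k) j1 = listTape-flatten bs k j1
listTape-flatten (block m f v ∷ bs) (suc k) j2 = listTape-flatten bs k j2

datum-blockAt : ∀ bs k → datum (blockAt bs k) ≡ listTape (map datum bs) k
datum-blockAt [] k = refl
datum-blockAt (b ∷ bs) zero = refl
datum-blockAt (b ∷ bs) (suc k) = datum-blockAt bs k

blockAt-all : ∀ p bs → AllBlocks p bs → p blank ≡ true → ∀ k → p (blockAt bs k) ≡ true
blockAt-all p [] _ pb k = pb
blockAt-all p (b ∷ bs) (pb' , _) pb zero = pb'
blockAt-all p (b ∷ bs) (_ , a) pb (suc k) = blockAt-all p bs a pb k

-- The machine P. Cells 0 … N' belong to the intervention and to β; from cell N = suc N' on the
-- tape is read as blocks of three cells (mark, flag, datum), see cellOf. The input is a sentinel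
-- block and one Unread block per bit of the code A of P's table. Tags: W walks to cell N, BM
-- moves blindly, SR* and SL* scan right and left over blocks, X* append a payload as Out blocks;
-- C1* and C2* process one source block in the first and second pass, which append the unary
-- length of d and the code of every block of d, so that the datum track becomes the encoding of
-- (P , d); RUN, DR* and DL* simulate one step of D on the datum track, Q reads D's answer, and
-- then P either LOOPs or writes the valuation (WV) and halts (DONE).
data RightScan : Set where r0 r1 r2 r3 r4 : RightScan
data LeftScan : Set where l0 l1 l2 l3 : LeftScan
data Writer : Set where w0 w1 w2 w3 w4 : Writer
data BlindMove : Set where bA bLP1 bLP2 bB1 bB2 bC2y bCL bH bPR bPL : BlindMove

data Tag : Set where
  W : Tag
  BM : BlindMove → Tag
  SRa : RightScan → Tag
  SRb : RightScan → Bool → Tag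
  SRc : RightScan → Tag
  Xm Xf Xv : Writer → Tag
  SLa : LeftScan → Tag
  SLb : LeftScan → Bool → Tag
  SLc SLd SLe : LeftScan → Tag
  C1 C1f C1v C2 C2f C2v C2x CL CLf RUN DR1 DR2 : Tag
  DL1 DL2 DL3 DL4 DL5 DL6 DL7 DL8 DL9 DL10 : Tag
  Q WV DONE LOOP : Tag

tagIndex : Tag → ℕ
tagIndex W = 0
tagIndex (BM bA) = 1
tagIndex (BM bLP1) = 2
tagIndex (BM bLP2) = 3
tagIndex (BM bB1) = 4
tagIndex (BM bB2) = 5
tagIndex (BM bC2y) = 6
tagIndex (BM bCL) = 7
tagIndex (BM bH) = 8
tagIndex (BM bPR) = 9
tagIndex (BM bPL) = 10
tagIndex (SRa r0) = 11
tagIndex (SRa r1) = 12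
tagIndex (SRa r2) = 13
tagIndex (SRa r3) = 14
tagIndex (SRa r4) = 15
tagIndex (SRb r0 false) = 16
tagIndex (SRb r0 true) = 17
tagIndex (SRb r1 false) = 18
tagIndex (SRb r1 true) = 19
tagIndex (SRb r2 false) = 20
tagIndex (SRb r2 true) = 21
tagIndex (SRb r3 false) = 22
tagIndex (SRb r3 true) = 23
tagIndex (SRb r4 false) = 24
tagIndex (SRb r4 true) = 25
tagIndex (SRc r0) = 26
tagIndex (SRc r1) = 27
tagIndex (SRc r2) = 28
tagIndex (SRc r3) = 29
tagIndex (SRc r4) = 30
tagIndex (Xm w0) = 31
tagIndex (Xm w1) = 32
tagIndex (Xm w2) = 33
tagIndex (Xm w3) = 34
tagIndex (Xm w4) = 35
tagIndex (Xf w0) = 36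
tagIndex (Xf w1) = 37
tagIndex (Xf w2) = 38
tagIndex (Xf w3) = 39
tagIndex (Xf w4) = 40
tagIndex (Xv w0) = 41
tagIndex (Xv w1) = 42
tagIndex (Xv w2) = 43
tagIndex (Xv w3) = 44
tagIndex (Xv w4) = 45
tagIndex (SLa l0) = 46
tagIndex (SLa l1) = 47
tagIndex (SLa l2) = 48
tagIndex (SLa l3) = 49
tagIndex (SLb l0 false) = 50
tagIndex (SLb l0 true) = 51
tagIndex (SLb l1 false) = 52
tagIndex (SLb l1 true) = 53
tagIndex (SLb l2 false) = 54
tagIndex (SLb l2 true) = 55
tagIndex (SLb l3 false) = 56
tagIndex (SLb l3 true) = 57
tagIndex (SLc l0) = 58
tagIndex (SLc l1) = 59
tagIndex (SLc l2) = 60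
tagIndex (SLc l3) = 61
tagIndex (SLd l0) = 62
tagIndex (SLd l1) = 63
tagIndex (SLd l2) = 64
tagIndex (SLd l3) = 65
tagIndex (SLe l0) = 66
tagIndex (SLe l1) = 67
tagIndex (SLe l2) = 68
tagIndex (SLe l3) = 69
tagIndex C1 = 70
tagIndex C1f = 71
tagIndex C1v = 72
tagIndex C2 = 73
tagIndex C2f = 74
tagIndex C2v = 75
tagIndex C2x = 76
tagIndex CL = 77
tagIndex CLf = 78
tagIndex RUN = 79
tagIndex DR1 = 80
tagIndex DR2 = 81
tagIndex DL1 = 82
tagIndex DL2 = 83
tagIndex DL3 = 84
tagIndex DL4 = 85
tagIndex DL5 = 86
tagIndex DL6 = 87
tagIndex DL7 = 88
tagIndex DL8 = 89
tagIndex DL9 = 90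
tagIndex DL10 = 91
tagIndex Q = 92
tagIndex WV = 93
tagIndex DONE = 94
tagIndex LOOP = 95

allTags : List Tag
allTags =
  W ∷ (BM bA) ∷ (BM bLP1) ∷ (BM bLP2) ∷ (BM bB1) ∷ (BM bB2) ∷ (BM bC2y) ∷ (BM bCL) ∷ (BM bH) ∷
  (BM bPR) ∷ (BM bPL) ∷ (SRa r0) ∷ (SRa r1) ∷ (SRa r2) ∷ (SRa r3) ∷ (SRa r4) ∷ (SRb r0 false) ∷
  (SRb r0 true) ∷ (SRb r1 false) ∷ (SRb r1 true) ∷ (SRb r2 false) ∷ (SRb r2 true) ∷
  (SRb r3 false) ∷ (SRb r3 true) ∷ (SRb r4 false) ∷ (SRb r4 true) ∷ (SRc r0) ∷ (SRc r1) ∷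
  (SRc r2) ∷ (SRc r3) ∷ (SRc r4) ∷ (Xm w0) ∷ (Xm w1) ∷ (Xm w2) ∷ (Xm w3) ∷ (Xm w4) ∷ (Xf w0) ∷
  (Xf w1) ∷ (Xf w2) ∷ (Xf w3) ∷ (Xf w4) ∷ (Xv w0) ∷ (Xv w1) ∷ (Xv w2) ∷ (Xv w3) ∷ (Xv w4) ∷
  (SLa l0) ∷ (SLa l1) ∷ (SLa l2) ∷ (SLa l3) ∷ (SLb l0 false) ∷ (SLb l0 true) ∷ (SLb l1 false) ∷
  (SLb l1 true) ∷ (SLb l2 false) ∷ (SLb l2 true) ∷ (SLb l3 false) ∷ (SLb l3 true) ∷ (SLc l0) ∷
  (SLc l1) ∷ (SLc l2) ∷ (SLc l3) ∷ (SLd l0) ∷ (SLd l1) ∷ (SLd l2) ∷ (SLd l3) ∷ (SLe l0) ∷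
  (SLe l1) ∷ (SLe l2) ∷ (SLe l3) ∷ C1 ∷ C1f ∷ C1v ∷ C2 ∷ C2f ∷ C2v ∷ C2x ∷ CL ∷ CLf ∷ RUN ∷ DR1 ∷
  DR2 ∷ DL1 ∷ DL2 ∷ DL3 ∷ DL4 ∷ DL5 ∷ DL6 ∷ DL7 ∷ DL8 ∷ DL9 ∷ DL10 ∷ Q ∷ WV ∷ DONE ∷ LOOP ∷ []

nth-allTags-tagIndex : ∀ g → nth allTags (tagIndex g) ≡ just g
nth-allTags-tagIndex W = refl
nth-allTags-tagIndex (BM bA) = refl
nth-allTags-tagIndex (BM bLP1) = refl
nth-allTags-tagIndex (BM bLP2) = refl
nth-allTags-tagIndex (BM bB1) = refl
nth-allTags-tagIndex (BM bB2) = refl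
nth-allTags-tagIndex (BM bC2y) = refl
nth-allTags-tagIndex (BM bCL) = refl
nth-allTags-tagIndex (BM bH) = refl
nth-allTags-tagIndex (BM bPR) = refl
nth-allTags-tagIndex (BM bPL) = refl
nth-allTags-tagIndex (SRa r0) = refl
nth-allTags-tagIndex (SRa r1) = refl
nth-allTags-tagIndex (SRa r2) = refl
nth-allTags-tagIndex (SRa r3) = refl
nth-allTags-tagIndex (SRa r4) = refl
nth-allTags-tagIndex (SRb r0 false) = refl
nth-allTags-tagIndex (SRb r0 true) = refl
nth-allTags-tagIndex (SRb r1 false) = refl
nth-allTags-tagIndex (SRb r1 true) = refl
nth-allTags-tagIndex (SRb r2 false) = refl
nth-allTags-tagIndex (SRb r2 true) = refl
nth-allTags-tagIndex (SRb r3 false) = refl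
nth-allTags-tagIndex (SRb r3 true) = refl
nth-allTags-tagIndex (SRb r4 false) = refl
nth-allTags-tagIndex (SRb r4 true) = refl
nth-allTags-tagIndex (SRc r0) = refl
nth-allTags-tagIndex (SRc r1) = refl
nth-allTags-tagIndex (SRc r2) = refl
nth-allTags-tagIndex (SRc r3) = refl
nth-allTags-tagIndex (SRc r4) = refl
nth-allTags-tagIndex (Xm w0) = refl
nth-allTags-tagIndex (Xm w1) = refl
nth-allTags-tagIndex (Xm w2) = refl
nth-allTags-tagIndex (Xm w3) = refl
nth-allTags-tagIndex (Xm w4) = refl
nth-allTags-tagIndex (Xf w0) = refl
nth-allTags-tagIndex (Xf w1) = refl
nth-allTags-tagIndex (Xf w2) = refl
nth-allTags-tagIndex (Xf w3) = refl
nth-allTags-tagIndex (Xf w4) = refl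
nth-allTags-tagIndex (Xv w0) = refl
nth-allTags-tagIndex (Xv w1) = refl
nth-allTags-tagIndex (Xv w2) = refl
nth-allTags-tagIndex (Xv w3) = refl
nth-allTags-tagIndex (Xv w4) = refl
nth-allTags-tagIndex (SLa l0) = refl
nth-allTags-tagIndex (SLa l1) = refl
nth-allTags-tagIndex (SLa l2) = refl
nth-allTags-tagIndex (SLa l3) = refl
nth-allTags-tagIndex (SLb l0 false) = refl
nth-allTags-tagIndex (SLb l0 true) = refl
nth-allTags-tagIndex (SLb l1 false) = refl
nth-allTags-tagIndex (SLb l1 true) = refl
nth-allTags-tagIndex (SLb l2 false) = refl
nth-allTags-tagIndex (SLb l2 true) = refl
nth-allTags-tagIndex (SLb l3 false) = refl
nth-allTags-tagIndex (SLb l3 true) = refl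
nth-allTags-tagIndex (SLc l0) = refl
nth-allTags-tagIndex (SLc l1) = refl
nth-allTags-tagIndex (SLc l2) = refl
nth-allTags-tagIndex (SLc l3) = refl
nth-allTags-tagIndex (SLd l0) = refl
nth-allTags-tagIndex (SLd l1) = refl
nth-allTags-tagIndex (SLd l2) = refl
nth-allTags-tagIndex (SLd l3) = refl
nth-allTags-tagIndex (SLe l0) = refl
nth-allTags-tagIndex (SLe l1) = refl
nth-allTags-tagIndex (SLe l2) = refl
nth-allTags-tagIndex (SLe l3) = refl
nth-allTags-tagIndex C1 = refl
nth-allTags-tagIndex C1f = refl
nth-allTags-tagIndex C1v = refl
nth-allTags-tagIndex C2 = refl
nth-allTags-tagIndex C2f = refl
nth-allTags-tagIndex C2v = refl
nth-allTags-tagIndex C2x = refl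
nth-allTags-tagIndex CL = refl
nth-allTags-tagIndex CLf = refl
nth-allTags-tagIndex RUN = refl
nth-allTags-tagIndex DR1 = refl
nth-allTags-tagIndex DR2 = refl
nth-allTags-tagIndex DL1 = refl
nth-allTags-tagIndex DL2 = refl
nth-allTags-tagIndex DL3 = refl
nth-allTags-tagIndex DL4 = refl
nth-allTags-tagIndex DL5 = refl
nth-allTags-tagIndex DL6 = refl
nth-allTags-tagIndex DL7 = refl
nth-allTags-tagIndex DL8 = refl
nth-allTags-tagIndex DL9 = refl
nth-allTags-tagIndex DL10 = refl
nth-allTags-tagIndex Q = refl
nth-allTags-tagIndex WV = refl
nth-allTags-tagIndex DONE = refl
nth-allTags-tagIndex LOOP = refl

blockCode : Bool → List Bool
blockCode a = encNats (map bitℕ (false ∷ true ∷ a ∷ []))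

blindDir : BlindMove → Move
blindDir bA = R
blindDir bLP1 = L
blindDir bLP2 = L
blindDir bB1 = R
blindDir bB2 = R
blindDir bC2y = L
blindDir bCL = R
blindDir bH = L
blindDir bPR = R
blindDir bPL = L

blindNext : BlindMove → Tag
blindNext bA = SRa r0
blindNext bLP1 = SLa l0
blindNext bLP2 = SLa l1
blindNext bB1 = C1
blindNext bB2 = C2
blindNext bC2y = SLa l2
blindNext bCL = RUN
blindNext bH = SLa l3
blindNext bPR = Q
blindNext bPL = WV

writerNext : Writer → Tag
writerNext w0 = BM bLP1
writerNext w1 = BM bLP1
writerNext w2 = BM bLP2
writerNext w3 = BM bLP2
writerNext w4 = BM bLP2

scanRightNext : RightScan → Tag
scanRightNext r0 = Xm w0
scanRightNext r1 = Xm w1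
scanRightNext r2 = Xm w2
scanRightNext r3 = Xm w3
scanRightNext r4 = Xm w4

scanLeftStop : LeftScan → Bool → Bool → Bool
scanLeftStop l0 m f = (m ∧ f) ∨ (not m ∧ not f)
scanLeftStop l1 m f = not m
scanLeftStop l2 m f = not f
scanLeftStop l3 m f = m ∧ f

scanLeftNext : LeftScan → Tag
scanLeftNext l0 = BM bB1
scanLeftNext l1 = BM bB2
scanLeftNext l2 = CL
scanLeftNext l3 = BM bPR

scanLeftNextParam : LeftScan → ℕ
scanLeftNextParam l0 = 2
scanLeftNextParam l1 = 2
scanLeftNextParam l2 = 0
scanLeftNextParam l3 = 4

afterMove : Move → Tag
afterMove R = DR1
afterMove L = DL1

runEntry : Maybe Transition → Bool → Maybe (Tag × ℕ × Bool × Move)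
runEntry (just t) x = just (afterMove (move t) , to t , write t , move t)
runEntry nothing x = just (BM bH , 0 , x , L)

scanLeftPasses : LeftScan → Block → Bool
scanLeftPasses l b = not (scanLeftStop l (mark b) (flag b))

module Program (N' : ℕ) (val : ℕ → Bool) (Dts : List Transition) (Dstates : ℕ) where

  N : ℕ
  N = suc N'

  payload : Writer → List Bool
  payload w0 = true ∷ (replicate N true ++ true ∷ true ∷ true ∷ [])
  payload w1 = true ∷ true ∷ true ∷ []
  payload w2 = false ∷ encNats (map bitℕ (replicate N false ++ false ∷ false ∷ true ∷ []))
  payload w3 = blockCode false
  payload w4 = blockCode true

  blindNextParam : BlindMove → ℕ
  blindNextParam bPL = N'
  blindNextParam _ = 0

  δ : Tag → ℕ → Bool → Maybe (Tag × ℕ × Bool × Move)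
  δ W i x = just ((if suc i ≡ᵇ N then BM bA else W) , (if suc i ≡ᵇ N then 2 else suc i) , x , R)
  δ (BM y) (suc i) x = just (BM y , i , x , blindDir y)
  δ (BM y) zero x = just (blindNext y , blindNextParam y , x , blindDir y)
  δ (SRa r) i x = just (SRb r x , 0 , x , R)
  δ (SRb r false) i false = just (scanRightNext r , 0 , false , L)
  δ (SRb r false) i true = just (SRc r , 0 , true , R)
  δ (SRb r true) i f = just (SRc r , 0 , f , R)
  δ (SRc r) i x = just (SRa r , 0 , x , R)
  δ (Xm w) i x = just (Xf w , i , true , R)
  δ (Xf w) i x = just (Xv w , i , false , R)
  δ (Xv w) i x = just ((if suc i ≡ᵇ length (payload w) then writerNext w else Xm w) ,
                       (if suc i ≡ᵇ length (payload w) then 2 else suc i) , nthBit (payload w) i , R)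
  δ (SLa l) i x = just (SLb l x , 0 , x , R)
  δ (SLb l m) i f = if scanLeftStop l m f then just (scanLeftNext l , scanLeftNextParam l , f , L) else just (SLc l , 0 , f , L)
  δ (SLc l) i x = just (SLd l , 0 , x , L)
  δ (SLd l) i x = just (SLe l , 0 , x , L)
  δ (SLe l) i x = just (SLa l , 0 , x , L)
  δ C1 i false = just (C1f , 0 , true , R)
  δ C1 i true = just (SRb r2 true , 0 , true , R)
  δ C1f i x = just (C1v , 0 , true , R)
  δ C1v i x = just (SRa r1 , 0 , x , R)
  δ C2 i true = just (C2f , 0 , false , R)
  δ C2 i false = nothing
  δ C2f i true = just (C2v , 0 , true , R)
  δ C2f i false = just (C2x , 0 , false , L)
  δ C2v i a = just (SRa (if a then r4 else r3) , 0 , a , R)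
  δ C2x i x = just (BM bC2y , 1 , true , L)
  δ CL i x = just (CLf , 0 , true , R)
  δ CLf i x = just (BM bCL , 2 , true , R)
  δ RUN q x = runEntry (lookupTransition Dts q x) x
  δ DR1 q x = just (DR2 , q , x , R)
  δ DR2 q x = just (RUN , q , x , R)
  δ DL1 q x = just (DL2 , q , x , L)
  δ DL2 q x = just (DL3 , q , x , L)
  δ DL3 q x = just (DL4 , q , x , L)
  δ DL4 q false = just (RUN , q , false , R)
  δ DL4 q true = just (DL5 , q , true , L)
  δ DL5 q false = just (DL6 , q , false , R)
  δ DL5 q true = just (DL7 , q , true , R)
  δ DL6 q x = just (RUN , q , x , R)
  δ DL7 q x = just (DL8 , q , x , R)
  δ DL8 q x = just (DL9 , q , x , R)
  δ DL9 q x = just (DL10 , q , x , R)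
  δ DL10 q x = just (RUN , q , x , R)
  δ Q i true = just (LOOP , 0 , true , R)
  δ Q i false = just (BM bPL , 4 , false , L)
  δ WV j x = just ((if j ≡ᵇ 0 then DONE else WV) , pred j , val j , L)
  δ DONE i x = nothing
  δ LOOP i x = just (LOOP , 0 , x , R)

  paramBound : ℕ
  paramBound = Dstates + (N + N + 10)

  open TableMachine Tag allTags tagIndex nth-allTags-tagIndex paramBound δ public

module Layout (N' : ℕ) (val : ℕ → Bool) (Dts : List Transition) (Dstates : ℕ)
         (fr : ℕ → Maybe Bool) (fr-beyond : ∀ i → suc N' ≤ i → fr i ≡ nothing) where

  open Program N' val Dts Dstates public

  cellOf : ℕ → Slot → ℕ
  cellOf k j = slotIndex j + k * 3 + N

  cellOf-injective : ∀ {k k' j j'} → cellOf k j ≡ cellOf k' j' → k ≡ k' × j ≡ j'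
  cellOf-injective {k} {k'} {j} {j'} e with divMod-injective {k = slotIndex j} {slotIndex j'} {k} {k'} (slotIndex<3 j) (slotIndex<3 j') (+-cancelʳ-≡ N _ _ e)
  ... | a , b = b , slotIndex-injective a

  N≤cellOf : ∀ k j → N ≤ cellOf k j
  N≤cellOf k j = m≤n+m N (slotIndex j + k * 3)

  cellOf-unfrozen : ∀ k j → is-nothing (fr (cellOf k j)) ≡ true
  cellOf-unfrozen k j rewrite fr-beyond (cellOf k j) (N≤cellOf k j) = refl

  Shows : Tape → (ℕ → Block) → Set
  Shows t g = ∀ k j → t (cellOf k j) ≡ readSlot j (g k)

  Shows-≗ : ∀ {t t' g} → t' ≗ t → Shows t g → Shows t' g
  Shows-≗ e l k j = trans (e (cellOf k j)) (l k j)

  Shows-cong : ∀ {t g g'} → (∀ k → g k ≡ g' k) → Shows t g → Shows t g'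
  Shows-cong e l k j = trans (l k j) (cong (readSlot j) (e k))

  Shows-write : ∀ {t g} k j x → Shows t g → Shows (writeTape fr (cellOf k j) x t) (update k (writeSlot j x (g k)) g)
  Shows-write {t} {g} k j x l k' j' with k' ≟ k
  ... | no ne = trans (write-elsewhere fr (cellOf k j) x t (cellOf k' j') (λ e → ne (proj₁ (cellOf-injective e))))
                      (trans (l k' j') (cong (readSlot j') (sym (update-there k _ g k' ne))))
  ... | yes refl with j' ≟ˢ j
  ... | yes refl =
        trans (write-here fr (cellOf k j) x t (cellOf-unfrozen k j))
              (sym (trans (cong (readSlot j) (update-here k (writeSlot j x (g k)) g)) (readSlot-writeSlot j x (g k))))
  ... | no ne =
        trans (write-elsewhere fr (cellOf k j) x t (cellOf k j') (λ e → ne (proj₂ (cellOf-injective {k} {k} {j'} {j} e))))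
              (trans (l k j') (trans (sym (readSlot-writeSlot-other j j' x (g k) ne))
                                     (cong (readSlot j') (sym (update-here k (writeSlot j x (g k)) g)))))

  Reaches : Config → ℕ → ℕ → (Tape → Set) → Set
  Reaches c s h P = ∃ λ t' → Star (Step tableMachine fr) c (cfg s h t') × P t'

  ReachesTag : Config → Tag → ℕ → ℕ → (Tape → Set) → Set
  ReachesTag c g i h P = Reaches c (stateCode g i) h P

  Reaches-map : ∀ {c s h} {P Q : Tape → Set} → (∀ t → P t → Q t) → Reaches c s h P → Reaches c s h Q
  Reaches-map f (t , r , p) = t , r , f t p

  Reaches-cons : ∀ {c c₁ s h} {P : Tape → Set} → Step tableMachine fr c c₁ → Reaches c₁ s h P → Reaches c s h P
  Reaches-cons st (t , r , p) = t , st ◅ r , p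

  _▷_ : ∀ {c s h s′ h′} {P Q : Tape → Set} → Reaches c s h P →
        (∀ t → P t → Reaches (cfg s h t) s′ h′ Q) → Reaches c s′ h′ Q
  (t , r , p) ▷ f with f t p
  ... | t′ , r′ , q = t′ , r ◅◅ r′ , q
  infixl 4 _▷_

  Reaches-block-cong : ∀ {c s p p′ P} → p ≡ p′ → Reaches c s (cellOf p j0) P → Reaches c s (cellOf p′ j0) P
  Reaches-block-cong refl r = r

  tableStep : ∀ {g i h t g' i' b' m} x → i < paramBound → t h ≡ x → δ g i x ≡ just (g' , i' , b' , m) →
        Step tableMachine fr (cfg (stateCode g i) h t) (cfg (stateCode g' i') (moveHead m h) (writeTape fr h b' t))
  tableStep x i< rd e = table-step i< refl rd e

  blindMove : ∀ y n h t → n < paramBound → ReachesTag (cfg (stateCode (BM y) n) h t) (blindNext y) (blindNextParam y) (moveHeadN (blindDir y) (suc n) h) (λ t' → t' ≗ t)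
  blindMove y zero h t n< = _ , tableStep (t h) n< refl refl ◅ ε , write-current fr h (t h) t refl
  blindMove y (suc n) h t n< with blindMove y n (moveHead (blindDir y) h) (writeTape fr h (t h) t) (<⇒≤ n<)
  ... | t' , r , e = t' , tableStep (t h) n< refl refl ◅ r , ≗-trans e (write-current fr h (t h) t refl)

  small<paramBound : ∀ {i} → i ≤ 9 → i < paramBound
  small<paramBound p = ≤-trans (s≤s p) (≤-trans (m≤n+m 10 (N + N)) (m≤n+m (N + N + 10) Dstates))

  0<paramBound : 0 < paramBound
  0<paramBound = small<paramBound z≤n

  scanRight : ∀ r n k t g → Shows t g → (∀ i → i < n → (mark (g (i + k)) ∨ flag (g (i + k))) ≡ true) →
          mark (g (n + k)) ≡ false → flag (g (n + k)) ≡ false →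
          ReachesTag (cfg (stateCode (SRa r) 0) (cellOf k j0) t) (scanRightNext r) 0 (cellOf (n + k) j0) (λ t' → t' ≗ t)
  scanRight r zero k t g l _ m0 f0 =
    _ , tableStep false 0<paramBound e0 refl ◅ tableStep false 0<paramBound e1 refl ◅ ε ,
    ≗-trans (write-current fr (cellOf k j1) false t1 e1) (write-current fr (cellOf k j0) false t e0)
    where e0 = trans (l k j0) m0
          t1 = writeTape fr (cellOf k j0) false t
          e1 : t1 (cellOf k j1) ≡ false
          e1 = trans (write-current fr (cellOf k j0) false t e0 (cellOf k j1)) (trans (l k j1) f0)
  scanRight r (suc n) k t g l nonBlank m0 f0 = go (mark (g k)) (flag (g k)) refl refl (nonBlank 0 (s≤s z≤n))
    where
      go : ∀ m f → mark (g k) ≡ m → flag (g k) ≡ f → (m ∨ f) ≡ true →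
           ReachesTag (cfg (stateCode (SRa r) 0) (cellOf k j0) t) (scanRightNext r) 0 (cellOf (suc n + k) j0) (λ t' → t' ≗ t)
      go m f em ef mf = res
        where
          e0 = trans (l k j0) em
          t1 = writeTape fr (cellOf k j0) m t
          q1 = write-current fr (cellOf k j0) m t e0
          e1 : t1 (cellOf k j1) ≡ f
          e1 = trans (q1 (cellOf k j1)) (trans (l k j1) ef)
          t2 = writeTape fr (cellOf k j1) f t1
          q2 = write-current fr (cellOf k j1) f t1 e1
          x = t2 (cellOf k j2)
          t3 = writeTape fr (cellOf k j2) x t2
          q3 = write-current fr (cellOf k j2) x t2 refl
          q123 : t3 ≗ t
          q123 = ≗-trans q3 (≗-trans q2 q1)
          s2 : Step tableMachine fr (cfg (stateCode (SRb r m) 0) (cellOf k j1) t1) (cfg (stateCode (SRc r) 0) (cellOf k j2) t2)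
          s2 = sub m f mf e1
            where sub : ∀ m f → (m ∨ f) ≡ true → t1 (cellOf k j1) ≡ f →
                        Step tableMachine fr (cfg (stateCode (SRb r m) 0) (cellOf k j1) t1) (cfg (stateCode (SRc r) 0) (cellOf k j2) (writeTape fr (cellOf k j1) f t1))
                  sub true f _ e = tableStep f 0<paramBound e refl
                  sub false true _ e = tableStep true 0<paramBound e refl
                  sub false false () e
          ih = scanRight r n (suc k) t3 g (Shows-≗ q123 l)
                 (λ i i< → subst (λ z → (mark (g z) ∨ flag (g z)) ≡ true) (sym (+-suc i k)) (nonBlank (suc i) (s≤s i<)))
                 (subst (λ z → mark (g z) ≡ false) (sym (+-suc n k)) m0)
                 (subst (λ z → flag (g z) ≡ false) (sym (+-suc n k)) f0)
          res : ReachesTag (cfg (stateCode (SRa r) 0) (cellOf k j0) t) (scanRightNext r) 0 (cellOf (suc n + k) j0) (λ t' → t' ≗ t)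
          res with ih
          ... | t' , run , eq rewrite +-suc n k =
                t' , tableStep m 0<paramBound e0 refl ◅ s2 ◅ tableStep x 0<paramBound refl refl ◅ run , ≗-trans eq q123

  if-true : ∀ {A : Set} {c} (a b : A) → c ≡ true → (if c then a else b) ≡ a
  if-true a b refl = refl

  if-false : ∀ {A : Set} {c} (a b : A) → c ≡ false → (if c then a else b) ≡ b
  if-false a b refl = refl

  scanLeft : ∀ l n k t g → Shows t g →
          (∀ i → i < n → scanLeftStop l (mark (g (suc i + k))) (flag (g (suc i + k))) ≡ false) →
          scanLeftStop l (mark (g k)) (flag (g k)) ≡ true →
          ReachesTag (cfg (stateCode (SLa l) 0) (cellOf (n + k) j0) t) (scanLeftNext l) (scanLeftNextParam l) (cellOf k j0) (λ t' → t' ≗ t)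
  scanLeft l zero k t g lay _ st =
    _ , tableStep (mark (g k)) 0<paramBound e0 refl ◅ tableStep (flag (g k)) 0<paramBound e1 (cong just' (if-true _ _ st)) ◅ ε ,
    ≗-trans (write-current fr (cellOf k j1) _ t1 e1) (write-current fr (cellOf k j0) _ t e0)
    where e0 = lay k j0
          t1 = writeTape fr (cellOf k j0) (mark (g k)) t
          e1 : t1 (cellOf k j1) ≡ flag (g k)
          e1 = trans (write-current fr (cellOf k j0) _ t e0 (cellOf k j1)) (lay k j1)
          just' : Maybe (Tag × ℕ × Bool × Move) → Maybe (Tag × ℕ × Bool × Move)
          just' x = x
  scanLeft l (suc n) k t g lay ns st = res
    where
      K = n + k
      e0 = lay (suc K) j0
      t1 = writeTape fr (cellOf (suc K) j0) (mark (g (suc K))) t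
      q1 = write-current fr (cellOf (suc K) j0) _ t e0
      e1 : t1 (cellOf (suc K) j1) ≡ flag (g (suc K))
      e1 = trans (q1 (cellOf (suc K) j1)) (lay (suc K) j1)
      t2 = writeTape fr (cellOf (suc K) j1) (flag (g (suc K))) t1
      q2 = write-current fr (cellOf (suc K) j1) _ t1 e1
      t3 = writeTape fr (cellOf (suc K) j0) (t2 (cellOf (suc K) j0)) t2
      q3 = write-current fr (cellOf (suc K) j0) _ t2 refl
      t4 = writeTape fr (cellOf K j2) (t3 (cellOf K j2)) t3
      q4 = write-current fr (cellOf K j2) _ t3 refl
      t5 = writeTape fr (cellOf K j1) (t4 (cellOf K j1)) t4
      q5 = write-current fr (cellOf K j1) _ t4 refl
      q : t5 ≗ t
      q = ≗-trans q5 (≗-trans q4 (≗-trans q3 (≗-trans q2 q1)))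
      ih = scanLeft l n k t5 g (Shows-≗ q lay) (λ i i< → ns i (≤-trans i< (n≤1+n n))) st
      res : ReachesTag (cfg (stateCode (SLa l) 0) (cellOf (suc n + k) j0) t) (scanLeftNext l) (scanLeftNextParam l) (cellOf k j0) (λ t' → t' ≗ t)
      res with ih
      ... | t' , run , eq =
        t' , tableStep (mark (g (suc K))) 0<paramBound e0 refl ◅ tableStep (flag (g (suc K))) 0<paramBound e1 (if-false _ _ (ns n ≤-refl))
             ◅ tableStep _ 0<paramBound refl refl ◅ tableStep _ 0<paramBound refl refl ◅ tableStep _ 0<paramBound refl refl ◅ run , ≗-trans eq q

  Out : Bool → Block
  Out x = block true false x

  appendOuts : ℕ → List Bool → (ℕ → Block) → ℕ → Block
  appendOuts k [] g = g
  appendOuts k (x ∷ xs) g = appendOuts (suc k) xs (update k (Out x) g)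

  nthBit-middle : ∀ pre x xs → nthBit (pre ++ x ∷ xs) (length pre) ≡ x
  nthBit-middle [] x xs = refl
  nthBit-middle (p ∷ pre) x xs = nthBit-middle pre x xs

  suc≡ᵇ+suc : ∀ j m → (suc j ≡ᵇ j + suc m) ≡ (0 ≡ᵇ m)
  suc≡ᵇ+suc zero m = refl
  suc≡ᵇ+suc (suc j) m = suc≡ᵇ+suc j m

  update-output : ∀ k x (g : ℕ → Block) m →
    update k (writeSlot j2 x (update k (writeSlot j1 false (update k (writeSlot j0 true (g k)) g k)) (update k (writeSlot j0 true (g k)) g) k))
        (update k (writeSlot j1 false (update k (writeSlot j0 true (g k)) g k)) (update k (writeSlot j0 true (g k)) g)) m
    ≡ update k (Out x) g m
  update-output k x g m with m ≟ k
  ... | yes refl rewrite ≡ᵇ-refl k = refl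
  ... | no ne rewrite ≢⇒≡ᵇfalse ne = refl

  writeOutput : ∀ w x (xs : List Bool) pre j k t g → length (payload w) ≤ paramBound → payload w ≡ pre ++ x ∷ xs → length pre ≡ j → Shows t g →
         ∃ λ t3 → Star (Step tableMachine fr) (cfg (stateCode (Xm w) j) (cellOf k j0) t)
                     (cfg (stateCode (if (0 ≡ᵇ length xs) then writerNext w else Xm w) (if (0 ≡ᵇ length xs) then 2 else suc j)) (cellOf (suc k) j0) t3)
                  × Shows t3 (update k (Out x) g)
  writeOutput w x xs pre j k t g pB pe lj lay =
    t3 , tableStep (t (cellOf k j0)) j<B refl refl ◅ tableStep (t1 (cellOf k j1)) j<B refl refl
         ◅ tableStep (t2 (cellOf k j2)) j<B refl (cong (λ z → just ((if z then writerNext w else Xm w) , (if z then 2 else suc j) , bit , R)) cnd) ◅ ε , lay3'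
    where
      j<B : j < paramBound
      j<B = ≤-trans (subst (_< length (payload w)) lj (subst (λ z → length pre < length z) (sym pe)
              (subst (length pre <_) (sym (LP.length-++ pre)) (m<m+n (length pre) (s≤s z≤n))))) pB
      g1 = update k (writeSlot j0 true (g k)) g
      t1 = writeTape fr (cellOf k j0) true t
      g2 = update k (writeSlot j1 false (g1 k)) g1
      t2 = writeTape fr (cellOf k j1) false t1
      bit = nthBit (payload w) j
      g3 = update k (writeSlot j2 bit (g2 k)) g2
      t3 = writeTape fr (cellOf k j2) bit t2
      lay3 : Shows t3 g3
      lay3 = Shows-write {t2} {g2} k j2 bit (Shows-write {t1} {g1} k j1 false (Shows-write {t} {g} k j0 true lay))
      bitx : bit ≡ x
      bitx = trans (cong₂ nthBit pe (sym lj)) (nthBit-middle pre x xs)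
      lay3' : Shows t3 (update k (Out x) g)
      lay3' = Shows-cong {t3} {g3} (λ m → trans (cong (λ z → update k (writeSlot j2 z (g2 k)) g2 m) bitx) (update-output k x g m)) lay3
      lenpay : length (payload w) ≡ j + suc (length xs)
      lenpay = trans (cong length pe) (trans (LP.length-++ pre) (cong (_+ suc (length xs)) lj))
      cnd : (suc j ≡ᵇ length (payload w)) ≡ (0 ≡ᵇ length xs)
      cnd = trans (cong (suc j ≡ᵇ_) lenpay) (suc≡ᵇ+suc j (length xs))

  writePayload⁺ : ∀ w x (xs : List Bool) pre j k t g → length (payload w) ≤ paramBound → payload w ≡ pre ++ x ∷ xs → length pre ≡ j →
           Shows t g →
           ReachesTag (cfg (stateCode (Xm w) j) (cellOf k j0) t) (writerNext w) 2 (cellOf (suc (length xs) + k) j0) (λ t' → Shows t' (appendOuts k (x ∷ xs) g))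
  writePayload⁺ w x [] pre j k t g pB pe lj lay = writeOutput w x [] pre j k t g pB pe lj lay
  writePayload⁺ w x (y ∷ ys) pre j k t g pB pe lj lay =
    proj₁ ih , proj₁ (proj₂ wb) ◅◅ run' , proj₂ (proj₂ ih)
    where
      wb = writeOutput w x (y ∷ ys) pre j k t g pB pe lj lay
      t3 = proj₁ wb
      ih = writePayload⁺ w y ys (pre ++ x ∷ []) (suc j) (suc k) t3 (update k (Out x) g) pB
                                 (trans pe (sym (LP.++-assoc pre (x ∷ []) (y ∷ ys))))
                                 (trans (LP.length-++ pre) (trans (+-comm (length pre) 1) (cong suc lj)))
                                 (proj₂ (proj₂ wb))
      run' = subst (λ z → Star (Step tableMachine fr) (cfg (stateCode (Xm w) (suc j)) (cellOf (suc k) j0) t3) (cfg (stateCode (writerNext w) 2) (cellOf z j0) (proj₁ ih))) (+-suc (suc (length ys)) k) (proj₁ (proj₂ ih))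

  writePayload : ∀ w (xs : List Bool) pre j k t g → length (payload w) ≤ paramBound → payload w ≡ pre ++ xs → length pre ≡ j →
           0 < length xs → Shows t g →
           ReachesTag (cfg (stateCode (Xm w) j) (cellOf k j0) t) (writerNext w) 2 (cellOf (length xs + k) j0) (λ t' → Shows t' (appendOuts k xs g))
  writePayload w (x ∷ xs) pre j k t g pB pe lj _ lay = writePayload⁺ w x xs pre j k t g pB pe lj lay

module FirstPass (N' : ℕ) (val : ℕ → Bool) (Dts : List Transition) (Dstates : ℕ)
         (fr : ℕ → Maybe Bool) (fr-beyond : ∀ i → suc N' ≤ i → fr i ≡ nothing) where

  open Layout N' val Dts Dstates fr fr-beyond public

  appendOuts-blockAt : ∀ ys bs g → (∀ m → g m ≡ blockAt bs m) → ∀ m → appendOuts (length bs) ys g m ≡ blockAt (bs ++ map Out ys) m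
  appendOuts-blockAt [] bs g e m = trans (e m) (cong (λ z → blockAt z m) (sym (LP.++-identityʳ bs)))
  appendOuts-blockAt (y ∷ ys) bs g e m =
    trans (subst (λ z → appendOuts z ys (update (length bs) (Out y) g) m ≡ blockAt ((bs ++ Out y ∷ []) ++ map Out ys) m)
                 (trans (LP.length-++ bs) (+-comm (length bs) 1))
                 (appendOuts-blockAt ys (bs ++ Out y ∷ []) (update (length bs) (Out y) g) (update-snoc bs (Out y) g e) m))
          (cong (λ z → blockAt z m) (LP.++-assoc bs (Out y ∷ []) (map Out ys)))

  length-++-flip : ∀ {A : Set} (xs ys : List A) → length (xs ++ ys) ≡ length ys + length xs
  length-++-flip xs ys = trans (LP.length-++ xs) (+-comm (length xs) (length ys))

  blockAt-skip : ∀ xs mid i → blockAt (sentinel ∷ (xs ++ mid)) (suc i + length xs) ≡ blockAt mid i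
  blockAt-skip xs mid i = trans (cong (blockAt (xs ++ mid)) (+-comm i (length xs))) (blockAt-++ xs mid i)

  seekFirstPass : ∀ xs mid t → Shows t (blockAt (sentinel ∷ (xs ++ mid))) →
          scanLeftStop l0 (mark (lastBlock sentinel xs)) (flag (lastBlock sentinel xs)) ≡ true → AllBlocks (scanLeftPasses l0) mid →
          ReachesTag (cfg (stateCode (BM bLP1) 2) (cellOf (length (sentinel ∷ (xs ++ mid))) j0) t) C1 0 (cellOf (suc (length xs)) j0) (λ t' → t' ≗ t)
  seekFirstPass xs mid t lay stp all with blindMove bLP1 2 (cellOf (length (sentinel ∷ (xs ++ mid))) j0) t (small<paramBound (s≤s (s≤s z≤n)))
  ... | t1 , run1 , q1 with scanLeft l0 (length mid) (length xs) t1 (blockAt (sentinel ∷ (xs ++ mid))) (Shows-≗ q1 lay)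
        (λ i i< → not-true (subst (λ z → (scanLeftPasses l0) z ≡ true) (sym (blockAt-skip xs mid i)) (blockAt-AllBlocks (scanLeftPasses l0) mid all i i<)))
        (subst (λ z → scanLeftStop l0 (mark z) (flag z) ≡ true) (sym (blockAt-last sentinel xs mid)) stp)
  ... | t2 , run2 , q2 with blindMove bB1 2 (cellOf (length xs) j0) t2 (small<paramBound (s≤s (s≤s z≤n)))
  ... | t3 , run3 , q3 = t3 , run1 ◅◅ run2' ◅◅ run3 , ≗-trans q3 (≗-trans q2 q1)
    where run2' = subst (λ z → Star (Step tableMachine fr) (cfg (stateCode (SLa l0) 0) (cellOf z j0) t1) (cfg (stateCode (BM bB1) 2) (cellOf (length xs) j0) t2))
                        (sym (length-++-flip xs mid)) run2

  seekSecondPass : ∀ xs mid t → Shows t (blockAt (sentinel ∷ (xs ++ mid))) →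
          scanLeftStop l1 (mark (lastBlock sentinel xs)) (flag (lastBlock sentinel xs)) ≡ true → AllBlocks (scanLeftPasses l1) mid →
          ReachesTag (cfg (stateCode (BM bLP2) 2) (cellOf (length (sentinel ∷ (xs ++ mid))) j0) t) C2 0 (cellOf (suc (length xs)) j0) (λ t' → t' ≗ t)
  seekSecondPass xs mid t lay stp all with blindMove bLP2 2 (cellOf (length (sentinel ∷ (xs ++ mid))) j0) t (small<paramBound (s≤s (s≤s z≤n)))
  ... | t1 , run1 , q1 with scanLeft l1 (length mid) (length xs) t1 (blockAt (sentinel ∷ (xs ++ mid))) (Shows-≗ q1 lay)
        (λ i i< → not-true (subst (λ z → (scanLeftPasses l1) z ≡ true) (sym (blockAt-skip xs mid i)) (blockAt-AllBlocks (scanLeftPasses l1) mid all i i<)))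
        (subst (λ z → scanLeftStop l1 (mark z) (flag z) ≡ true) (sym (blockAt-last sentinel xs mid)) stp)
  ... | t2 , run2 , q2 with blindMove bB2 2 (cellOf (length xs) j0) t2 (small<paramBound (s≤s (s≤s z≤n)))
  ... | t3 , run3 , q3 = t3 , run1 ◅◅ run2' ◅◅ run3 , ≗-trans q3 (≗-trans q2 q1)
    where run2' = subst (λ z → Star (Step tableMachine fr) (cfg (stateCode (SLa l1) 0) (cellOf z j0) t1) (cfg (stateCode (BM bB2) 2) (cellOf (length xs) j0) t2))
                        (sym (length-++-flip xs mid)) run2

  +-suc-comm : ∀ a b → a + suc b ≡ b + suc a
  +-suc-comm a b = trans (+-suc a b) (trans (cong suc (+-comm a b)) (sym (+-suc b a)))

  blockAt-middle : ∀ xs b rest → blockAt (xs ++ b ∷ rest) (length xs) ≡ b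
  blockAt-middle [] b rest = refl
  blockAt-middle (x ∷ xs) b rest = blockAt-middle xs b rest

  update-twice : ∀ k (x y : Bool) g m → update k (writeSlot j1 y (update k (writeSlot j0 x (g k)) g k)) (update k (writeSlot j0 x (g k)) g) m
                              ≡ update k (writeSlot j1 y (writeSlot j0 x (g k))) g m
  update-twice k x y g m with m ≟ k
  ... | yes refl rewrite ≡ᵇ-refl k = refl
  ... | no ne rewrite ≢⇒≡ᵇfalse ne = refl

  markRead : ∀ xs a rest t → Shows t (blockAt (sentinel ∷ (xs ++ Unread a ∷ rest))) →
          ReachesTag (cfg (stateCode C1 0) (cellOf (suc (length xs)) j0) t) (SRa r1) 0 (cellOf (suc (suc (length xs))) j0)
                (λ t' → Shows t' (blockAt (sentinel ∷ (xs ++ Read a ∷ rest))))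
  markRead xs a rest t lay =
    t3 , tableStep {g = C1} {i = 0} false 0<paramBound e0 refl ◅ tableStep {g = C1f} {i = 0} (t1 (cellOf K j1)) 0<paramBound refl refl ◅ tableStep {g = C1v} {i = 0} (t2 (cellOf K j2)) 0<paramBound refl refl ◅ ε ,
    Shows-≗ (write-current fr (cellOf K j2) _ t2 refl) lay2'
    where
      K = suc (length xs)
      g = blockAt (sentinel ∷ (xs ++ Unread a ∷ rest))
      gK : g K ≡ Unread a
      gK = blockAt-middle xs (Unread a) rest
      e0 : t (cellOf K j0) ≡ false
      e0 = trans (lay K j0) (cong mark gK)
      t1 = writeTape fr (cellOf K j0) true t
      g1 = update K (writeSlot j0 true (g K)) g
      t2 = writeTape fr (cellOf K j1) true t1
      g2 = update K (writeSlot j1 true (g1 K)) g1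
      t3 = writeTape fr (cellOf K j2) (t2 (cellOf K j2)) t2
      lay2 : Shows t2 g2
      lay2 = Shows-write {t1} {g1} K j1 true (Shows-write {t} {g} K j0 true lay)
      lay2' : Shows t2 (blockAt (sentinel ∷ (xs ++ Read a ∷ rest)))
      lay2' = Shows-cong {t2} {g2} (λ m → trans (update-twice K true true g m)
                (trans (cong (λ z → update K (writeSlot j1 true (writeSlot j0 true z)) g m) gK)
                       (update-middle (sentinel ∷ xs) (Unread a) (Read a) rest g (λ _ → refl) m))) lay2

  firstPass-stop : ∀ ps → scanLeftStop l0 (mark (lastBlock sentinel (map Read ps))) (flag (lastBlock sentinel (map Read ps))) ≡ true
  firstPass-stop ps = go sentinel ps refl
    where go : ∀ x ps → scanLeftStop l0 (mark x) (flag x) ≡ true → scanLeftStop l0 (mark (lastBlock x (map Read ps))) (flag (lastBlock x (map Read ps))) ≡ true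
          go x [] s = s
          go x (p ∷ ps) s = go (Read p) ps refl

  secondPass-stop : ∀ ps → scanLeftStop l1 (mark (lastBlock sentinel (map Unread ps))) (flag (lastBlock sentinel (map Unread ps))) ≡ true
  secondPass-stop ps = go sentinel ps refl
    where go : ∀ x ps → scanLeftStop l1 (mark x) (flag x) ≡ true → scanLeftStop l1 (mark (lastBlock x (map Unread ps))) (flag (lastBlock x (map Unread ps))) ≡ true
          go x [] s = s
          go x (p ∷ ps) s = go (Unread p) ps refl

  blockAt-after : ∀ xs (b : Block) rest i → blockAt (xs ++ b ∷ rest) (suc (i + length xs)) ≡ blockAt rest i
  blockAt-after [] b rest i = cong (blockAt rest) (+-identityʳ i)
  blockAt-after (x ∷ xs) b rest i = trans (cong (blockAt (xs ++ b ∷ rest)) (+-suc i (length xs))) (blockAt-after xs b rest i)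

  scanToEnd : ∀ r xs b rest t → Shows t (blockAt (sentinel ∷ (xs ++ b ∷ rest))) → AllBlocks nonBlank rest →
             ReachesTag (cfg (stateCode (SRa r) 0) (cellOf (suc (suc (length xs))) j0) t) (scanRightNext r) 0
                   (cellOf (length (sentinel ∷ (xs ++ b ∷ rest))) j0) (λ t' → t' ≗ t)
  scanToEnd r xs b rest t lay all with scanRight r (length rest) (suc (suc (length xs))) t (blockAt (sentinel ∷ (xs ++ b ∷ rest))) lay
        (λ i i< → subst (λ z → nonBlank z ≡ true) (sym (trans (cong (blockAt (sentinel ∷ (xs ++ b ∷ rest))) (+-suc i (suc (length xs))))
                        (trans (cong (blockAt (xs ++ b ∷ rest)) (+-suc i (length xs))) (blockAt-after xs b rest i))))
                        (blockAt-AllBlocks nonBlank rest all i i<))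
        (cong mark (e1)) (cong flag e1)
    where e1 : blockAt (sentinel ∷ (xs ++ b ∷ rest)) (length rest + suc (suc (length xs))) ≡ blank
          e1 = trans (cong (blockAt (sentinel ∷ (xs ++ b ∷ rest))) (+-suc (length rest) (suc (length xs))))
                (trans (cong (blockAt (xs ++ b ∷ rest)) (+-suc (length rest) (length xs)))
                (trans (blockAt-after xs b rest (length rest)) (trans (cong (blockAt rest) (sym (+-identityʳ _))) (blockAt-beyond rest 0))))
  ... | t' , run , q = t' , subst (λ z → Star (Step tableMachine fr) (cfg (stateCode (SRa r) 0) (cellOf (suc (suc (length xs))) j0) t) (cfg (stateCode (scanRightNext r) 0) (cellOf z j0) t')) eqn run , q
    where eqn : length rest + suc (suc (length xs)) ≡ length (sentinel ∷ (xs ++ b ∷ rest))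
          eqn = trans (+-suc (length rest) (suc (length xs))) (cong suc (trans (+-suc-comm (length rest) (length xs)) (sym (LP.length-++ xs))))

  N+N+10≤paramBound : N + N + 10 ≤ paramBound
  N+N+10≤paramBound = m≤n+m (N + N + 10) Dstates

  length-encNats-zeros : ∀ n ys → length (encNats (map bitℕ (replicate n false ++ ys))) ≡ n + n + length (encNats (map bitℕ ys))
  length-encNats-zeros zero ys = refl
  length-encNats-zeros (suc m) ys = cong suc (trans (cong suc (length-encNats-zeros m ys)) (sym (cong (_+ length (encNats (map bitℕ ys))) (+-suc m m))))

  payload≤paramBound : ∀ w → length (payload w) ≤ paramBound
  payload≤paramBound w0 = ≤-trans (≤-reflexive (cong suc (trans (LP.length-++ (replicate N true)) (cong (_+ 3) (LP.length-replicate N)))))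
             (≤-trans (s≤s (+-monoˡ-≤ 3 (m≤m+n N N))) (≤-trans (≤-reflexive (sym (+-suc (N + N) 3))) (≤-trans (+-monoʳ-≤ (N + N) (s≤s (s≤s (s≤s (s≤s z≤n))))) N+N+10≤paramBound)))
  payload≤paramBound w1 = <⇒≤ (small<paramBound (s≤s (s≤s (s≤s z≤n))))
  payload≤paramBound w2 = ≤-trans (≤-reflexive (cong suc (length-encNats-zeros N (false ∷ false ∷ true ∷ []))))
             (≤-trans (≤-reflexive (sym (+-suc (N + N) 7))) (≤-trans (+-monoʳ-≤ (N + N) (s≤s (s≤s (s≤s (s≤s (s≤s (s≤s (s≤s (s≤s z≤n))))))))) N+N+10≤paramBound))
  payload≤paramBound w3 = <⇒≤ (small<paramBound (s≤s (s≤s (s≤s (s≤s (s≤s (s≤s (s≤s z≤n))))))))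
  payload≤paramBound w4 = <⇒≤ (small<paramBound (s≤s (s≤s (s≤s (s≤s (s≤s (s≤s (s≤s (s≤s z≤n)))))))))

  unaryTriples : List Bool → List Bool
  unaryTriples [] = []
  unaryTriples (_ ∷ ps) = payload w1 ++ unaryTriples ps

  ones3-snoc : ∀ ps a → unaryTriples (ps ++ a ∷ []) ≡ unaryTriples ps ++ payload w1
  ones3-snoc [] a = refl
  ones3-snoc (p ∷ ps) a = cong (λ z → true ∷ true ∷ true ∷ z) (ones3-snoc ps a)

  firstPassOutput : List Bool → List Bool
  firstPassOutput ps = payload w0 ++ unaryTriples ps

  firstPassBlocks : List Bool → List Bool → List Block
  firstPassBlocks ps us = sentinel ∷ (map Read ps ++ (map Unread us ++ map Out (firstPassOutput ps)))

  firstPassDone : List Bool → List Block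
  firstPassDone ps = sentinel ∷ (map Read ps ++ map Out (firstPassOutput ps ++ payload w2))

  AllBlocks-nonBlank-Out : ∀ xs → AllBlocks nonBlank (map Out xs)
  AllBlocks-nonBlank-Out xs = AllBlocks-map nonBlank Out xs (λ _ → refl)

  firstPassBlocks-step : ∀ ps a us' → (sentinel ∷ (map Read ps ++ Read a ∷ (map Unread us' ++ map Out (firstPassOutput ps)))) ++ map Out (payload w1) ≡ firstPassBlocks (ps ++ a ∷ []) us'
  firstPassBlocks-step ps a us' = cong (sentinel ∷_) (begin
      (map Read ps ++ Read a ∷ (map Unread us' ++ map Out (firstPassOutput ps))) ++ map Out (payload w1)
        ≡⟨ LP.++-assoc (map Read ps) (Read a ∷ (map Unread us' ++ map Out (firstPassOutput ps))) (map Out (payload w1)) ⟩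
      map Read ps ++ Read a ∷ ((map Unread us' ++ map Out (firstPassOutput ps)) ++ map Out (payload w1))
        ≡⟨ cong (λ z → map Read ps ++ Read a ∷ z) (LP.++-assoc (map Unread us') (map Out (firstPassOutput ps)) (map Out (payload w1))) ⟩
      map Read ps ++ Read a ∷ (map Unread us' ++ (map Out (firstPassOutput ps) ++ map Out (payload w1)))
        ≡⟨ cong (λ z → map Read ps ++ Read a ∷ (map Unread us' ++ z)) (sym (LP.map-++ Out (firstPassOutput ps) (payload w1))) ⟩
      map Read ps ++ Read a ∷ (map Unread us' ++ map Out (firstPassOutput ps ++ payload w1))
        ≡⟨ cong (λ z → map Read ps ++ Read a ∷ (map Unread us' ++ map Out z)) (trans (LP.++-assoc (payload w0) (unaryTriples ps) (payload w1)) (cong (payload w0 ++_) (sym (ones3-snoc ps a)))) ⟩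
      map Read ps ++ Read a ∷ (map Unread us' ++ map Out (firstPassOutput (ps ++ a ∷ [])))
        ≡⟨ sym (LP.++-assoc (map Read ps) (Read a ∷ []) _) ⟩
      (map Read ps ++ Read a ∷ []) ++ (map Unread us' ++ map Out (firstPassOutput (ps ++ a ∷ [])))
        ≡⟨ cong (_++ (map Unread us' ++ map Out (firstPassOutput (ps ++ a ∷ [])))) (sym (LP.map-++ Read ps (a ∷ []))) ⟩
      map Read (ps ++ a ∷ []) ++ (map Unread us' ++ map Out (firstPassOutput (ps ++ a ∷ [])))
      ∎)
    where open ≡-Reasoning

  firstPassBlocks-done : ∀ ps → firstPassBlocks ps [] ++ map Out (payload w2) ≡ firstPassDone ps
  firstPassBlocks-done ps = cong (sentinel ∷_) (trans (LP.++-assoc (map Read ps) (map Out (firstPassOutput ps)) (map Out (payload w2)))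
                 (cong (map Read ps ++_) (sym (LP.map-++ Out (firstPassOutput ps) (payload w2)))))

  length-append : ∀ (bs : List Block) (ys : List Bool) bs' → bs ++ map Out ys ≡ bs' → length ys + length bs ≡ length bs'
  length-append bs ys bs' e = trans (+-comm (length ys) (length bs)) (trans (cong (length bs +_) (sym (LP.length-map Out ys)))
                       (trans (sym (LP.length-++ bs)) (cong length e)))

  payload-nonempty : ∀ w → 0 < length (payload w)
  payload-nonempty w0 = s≤s z≤n
  payload-nonempty w1 = s≤s z≤n
  payload-nonempty w2 = s≤s z≤n
  payload-nonempty w3 = s≤s z≤n
  payload-nonempty w4 = s≤s z≤n

  appendPayload : ∀ w bs {bs′} t → bs ++ map Out (payload w) ≡ bs′ → Shows t (blockAt bs) →
                  ReachesTag (cfg (stateCode (Xm w) 0) (cellOf (length bs) j0) t) (writerNext w) 2 (cellOf (length bs′) j0)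
                             (λ t′ → Shows t′ (blockAt bs′))
  appendPayload w bs t eq lay =
    Reaches-block-cong (length-append bs (payload w) _ eq)
      (Reaches-map (λ t′ l → Shows-cong {t′} (λ m → trans (appendOuts-blockAt (payload w) bs (blockAt bs) (λ _ → refl) m)
                                                           (cong (λ z → blockAt z m) eq)) l)
        (writePayload w (payload w) [] 0 (length bs) t (blockAt bs) (payload≤paramBound w) refl refl (payload-nonempty w) lay))

  firstPass-finish : ∀ ps t → Shows t (blockAt (firstPassBlocks ps [])) →
                     ReachesTag (cfg (stateCode (BM bLP1) 2) (cellOf (length (firstPassBlocks ps [])) j0) t) (BM bLP2) 2
                                (cellOf (length (firstPassDone ps)) j0) (λ t′ → Shows t′ (blockAt (firstPassDone ps)))
  firstPass-finish ps t lay =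
    (tc , proj₁ (proj₂ s1) ◅◅ stepsC , Shows-≗ qc lay1)
    ▷ (λ tc′ lc → Reaches-map (λ t′ q → Shows-≗ {t' = t′} q lc)
                    (scanToEnd r2 xs (Out true) (map Out rest1) tc′ lc (AllBlocks-nonBlank-Out rest1)))
    ▷ (λ td ld → appendPayload w2 bs td (firstPassBlocks-done ps) ld)
    where
      xs = map Read ps
      rest1 = (replicate N true ++ true ∷ true ∷ true ∷ []) ++ unaryTriples ps
      bs = sentinel ∷ (xs ++ Out true ∷ map Out rest1)
      K = suc (length xs)
      s1 = seekFirstPass xs (map Out (firstPassOutput ps)) t lay (firstPass-stop ps)
                         (AllBlocks-map (scanLeftPasses l0) Out (firstPassOutput ps) (λ _ → refl))
      t1 = proj₁ s1
      lay1 : Shows t1 (blockAt bs)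
      lay1 = Shows-≗ (proj₂ (proj₂ s1)) lay
      e0 : t1 (cellOf K j0) ≡ true
      e0 = trans (lay1 K j0) (cong mark (blockAt-middle xs (Out true) (map Out rest1)))
      ta = writeTape fr (cellOf K j0) true t1
      tb = writeTape fr (cellOf K j1) (ta (cellOf K j1)) ta
      tc = writeTape fr (cellOf K j2) (tb (cellOf K j2)) tb
      qc : tc ≗ t1
      qc = ≗-trans (write-current fr (cellOf K j2) _ tb refl)
                   (≗-trans (write-current fr (cellOf K j1) _ ta refl) (write-current fr (cellOf K j0) true t1 e0))
      stepsC : Star (Step tableMachine fr) (cfg (stateCode C1 0) (cellOf K j0) t1) (cfg (stateCode (SRa r2) 0) (cellOf (suc K) j0) tc)
      stepsC = tableStep {g = C1} {i = 0} true 0<paramBound e0 refl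
               ◅ tableStep {g = SRb r2 true} {i = 0} (ta (cellOf K j1)) 0<paramBound refl refl
               ◅ tableStep {g = SRc r2} {i = 0} (tb (cellOf K j2)) 0<paramBound refl refl ◅ ε

  firstPassDone-cong : ∀ {c ps ps′} → ps ≡ ps′ →
                       ReachesTag c (BM bLP2) 2 (cellOf (length (firstPassDone ps)) j0) (λ t′ → Shows t′ (blockAt (firstPassDone ps))) →
                       ReachesTag c (BM bLP2) 2 (cellOf (length (firstPassDone ps′)) j0) (λ t′ → Shows t′ (blockAt (firstPassDone ps′)))
  firstPassDone-cong refl r = r

  firstPass : ∀ us ps t → Shows t (blockAt (firstPassBlocks ps us)) →
              ReachesTag (cfg (stateCode (BM bLP1) 2) (cellOf (length (firstPassBlocks ps us)) j0) t) (BM bLP2) 2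
                         (cellOf (length (firstPassDone (ps ++ us))) j0) (λ t′ → Shows t′ (blockAt (firstPassDone (ps ++ us))))
  firstPass [] ps t lay = firstPassDone-cong (sym (LP.++-identityʳ ps)) (firstPass-finish ps t lay)
  firstPass (a ∷ us′) ps t lay = firstPassDone-cong (LP.++-assoc ps (a ∷ []) us′) res
    where
      xs = map Read ps
      rest = map Unread us′ ++ map Out (firstPassOutput ps)
      allmid : AllBlocks (scanLeftPasses l0) (Unread a ∷ rest)
      allmid = refl , AllBlocks-++ (scanLeftPasses l0) (map Unread us′) _ (AllBlocks-map (scanLeftPasses l0) Unread us′ (λ _ → refl))
                                   (AllBlocks-map (scanLeftPasses l0) Out (firstPassOutput ps) (λ _ → refl))
      allnb : AllBlocks nonBlank rest
      allnb = AllBlocks-++ nonBlank (map Unread us′) _ (AllBlocks-map nonBlank Unread us′ (λ _ → refl)) (AllBlocks-nonBlank-Out (firstPassOutput ps))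
      res : ReachesTag (cfg (stateCode (BM bLP1) 2) (cellOf (length (firstPassBlocks ps (a ∷ us′))) j0) t) (BM bLP2) 2
                       (cellOf (length (firstPassDone ((ps ++ a ∷ []) ++ us′))) j0) (λ t′ → Shows t′ (blockAt (firstPassDone ((ps ++ a ∷ []) ++ us′))))
      res = seekFirstPass xs (Unread a ∷ rest) t lay (firstPass-stop ps) allmid
            ▷ (λ t1 q1 → markRead xs a rest t1 (Shows-≗ {t' = t1} q1 lay))
            ▷ (λ t2 l2 → Reaches-map (λ t′ q → Shows-≗ {t' = t′} q l2) (scanToEnd r1 xs (Read a) rest t2 l2 allnb))
            ▷ (λ t3 l3 → appendPayload w1 (sentinel ∷ (xs ++ Read a ∷ rest)) t3 (firstPassBlocks-step ps a us′) l3)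
            ▷ (λ t4 l4 → firstPass us′ (ps ++ a ∷ []) t4 l4)

  lengthAndPrefixCode : List Bool → List Bool
  lengthAndPrefixCode A = firstPassOutput A ++ payload w2

  blockCodes : List Bool → List Bool
  blockCodes [] = []
  blockCodes (a ∷ ps) = blockCode a ++ blockCodes ps

  blockCodes-snoc : ∀ ps a → blockCodes (ps ++ a ∷ []) ≡ blockCodes ps ++ blockCode a
  blockCodes-snoc [] a = LP.++-identityʳ (blockCode a)
  blockCodes-snoc (p ∷ ps) a = trans (cong (blockCode p ++_) (blockCodes-snoc ps a)) (sym (LP.++-assoc (blockCode p) (blockCodes ps) (blockCode a)))

  leftEnd : Block
  leftEnd = block true true true

  secondPassBlocks : List Bool → List Bool → List Bool → List Block
  secondPassBlocks A ps us = sentinel ∷ (map Unread ps ++ (map Read us ++ map Out (lengthAndPrefixCode A ++ blockCodes ps)))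

  simulationBlocks : List Bool → List Bool → List Block
  simulationBlocks A ps = leftEnd ∷ (map Unread ps ++ map Out (lengthAndPrefixCode A ++ blockCodes ps))

  writerFor : Bool → Writer
  writerFor false = w3
  writerFor true = w4

  scanFor : Bool → RightScan
  scanFor false = r3
  scanFor true = r4

  markUnread : ∀ xs a rest t → Shows t (blockAt (sentinel ∷ (xs ++ Read a ∷ rest))) →
          ReachesTag (cfg (stateCode C2 0) (cellOf (suc (length xs)) j0) t) (SRa (scanFor a)) 0 (cellOf (suc (suc (length xs))) j0)
                (λ t' → Shows t' (blockAt (sentinel ∷ (xs ++ Unread a ∷ rest))))
  markUnread xs a rest t lay =
    t3 , tableStep {g = C2} {i = 0} true 0<paramBound e0 refl ◅ tableStep {g = C2f} {i = 0} true 0<paramBound e1 refl ◅ tableStep {g = C2v} {i = 0} a 0<paramBound e2 (dv a) ◅ ε ,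
    Shows-≗ (write-current fr (cellOf K j2) _ t2 e2) lay2'
    where
      K = suc (length xs)
      g = blockAt (sentinel ∷ (xs ++ Read a ∷ rest))
      gK : g K ≡ Read a
      gK = blockAt-middle xs (Read a) rest
      e0 : t (cellOf K j0) ≡ true
      e0 = trans (lay K j0) (cong mark gK)
      t1 = writeTape fr (cellOf K j0) false t
      g1 = update K (writeSlot j0 false (g K)) g
      lay1 : Shows t1 g1
      lay1 = Shows-write {t} {g} K j0 false lay
      e1 : t1 (cellOf K j1) ≡ true
      e1 = trans (lay1 K j1) (trans (cong (λ z → flag (writeSlot j0 false z)) (update-here K (writeSlot j0 false (g K)) g)) (cong (λ z → flag (writeSlot j0 false z)) gK))
      t2 = writeTape fr (cellOf K j1) true t1
      g2 = update K (writeSlot j1 true (g1 K)) g1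
      lay2 : Shows t2 g2
      lay2 = Shows-write {t1} {g1} K j1 true lay1
      lay2' : Shows t2 (blockAt (sentinel ∷ (xs ++ Unread a ∷ rest)))
      lay2' = Shows-cong {t2} {g2} (λ m → trans (update-twice K false true g m)
                (trans (cong (λ z → update K (writeSlot j1 true (writeSlot j0 false z)) g m) gK)
                       (update-middle (sentinel ∷ xs) (Read a) (Unread a) rest g (λ _ → refl) m))) lay2
      e2 : t2 (cellOf K j2) ≡ a
      e2 = trans (lay2' K j2) (cong datum (blockAt-middle xs (Unread a) rest))
      t3 = writeTape fr (cellOf K j2) a t2
      dv : ∀ a → δ C2v 0 a ≡ just (SRa (scanFor a) , 0 , a , R)
      dv false = refl
      dv true = refl

  secondPassBlocks-step : ∀ A ps a us' → (sentinel ∷ (map Unread ps ++ Unread a ∷ (map Read us' ++ map Out (lengthAndPrefixCode A ++ blockCodes ps)))) ++ map Out (blockCode a) ≡ secondPassBlocks A (ps ++ a ∷ []) us'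
  secondPassBlocks-step A ps a us' = cong (sentinel ∷_) (begin
      (map Unread ps ++ Unread a ∷ (map Read us' ++ map Out (lengthAndPrefixCode A ++ blockCodes ps))) ++ map Out (blockCode a)
        ≡⟨ LP.++-assoc (map Unread ps) (Unread a ∷ (map Read us' ++ map Out (lengthAndPrefixCode A ++ blockCodes ps))) (map Out (blockCode a)) ⟩
      map Unread ps ++ Unread a ∷ ((map Read us' ++ map Out (lengthAndPrefixCode A ++ blockCodes ps)) ++ map Out (blockCode a))
        ≡⟨ cong (λ z → map Unread ps ++ Unread a ∷ z) (LP.++-assoc (map Read us') (map Out (lengthAndPrefixCode A ++ blockCodes ps)) (map Out (blockCode a))) ⟩
      map Unread ps ++ Unread a ∷ (map Read us' ++ (map Out (lengthAndPrefixCode A ++ blockCodes ps) ++ map Out (blockCode a)))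
        ≡⟨ cong (λ z → map Unread ps ++ Unread a ∷ (map Read us' ++ z)) (sym (LP.map-++ Out (lengthAndPrefixCode A ++ blockCodes ps) (blockCode a))) ⟩
      map Unread ps ++ Unread a ∷ (map Read us' ++ map Out ((lengthAndPrefixCode A ++ blockCodes ps) ++ blockCode a))
        ≡⟨ cong (λ z → map Unread ps ++ Unread a ∷ (map Read us' ++ map Out z)) (trans (LP.++-assoc (lengthAndPrefixCode A) (blockCodes ps) (blockCode a)) (cong (lengthAndPrefixCode A ++_) (sym (blockCodes-snoc ps a)))) ⟩
      map Unread ps ++ Unread a ∷ (map Read us' ++ map Out (lengthAndPrefixCode A ++ blockCodes (ps ++ a ∷ [])))
        ≡⟨ sym (LP.++-assoc (map Unread ps) (Unread a ∷ []) _) ⟩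
      (map Unread ps ++ Unread a ∷ []) ++ (map Read us' ++ map Out (lengthAndPrefixCode A ++ blockCodes (ps ++ a ∷ [])))
        ≡⟨ cong (_++ (map Read us' ++ map Out (lengthAndPrefixCode A ++ blockCodes (ps ++ a ∷ [])))) (sym (LP.map-++ Unread ps (a ∷ []))) ⟩
      map Unread (ps ++ a ∷ []) ++ (map Read us' ++ map Out (lengthAndPrefixCode A ++ blockCodes (ps ++ a ∷ [])))
      ∎)
    where open ≡-Reasoning

  scanToEnd-for : ∀ a xs b rest t → Shows t (blockAt (sentinel ∷ (xs ++ b ∷ rest))) → AllBlocks nonBlank rest →
             ReachesTag (cfg (stateCode (SRa (scanFor a)) 0) (cellOf (suc (suc (length xs))) j0) t) (Xm (writerFor a)) 0
                   (cellOf (length (sentinel ∷ (xs ++ b ∷ rest))) j0) (λ t' → t' ≗ t)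
  scanToEnd-for false = scanToEnd r3
  scanToEnd-for true = scanToEnd r4

  appendBlockCode : ∀ a bs {bs′} t → bs ++ map Out (blockCode a) ≡ bs′ → Shows t (blockAt bs) →
                    ReachesTag (cfg (stateCode (Xm (writerFor a)) 0) (cellOf (length bs) j0) t) (BM bLP2) 2 (cellOf (length bs′) j0)
                               (λ t′ → Shows t′ (blockAt bs′))
  appendBlockCode false = appendPayload w3
  appendBlockCode true = appendPayload w4

module SecondPass (N' : ℕ) (val : ℕ → Bool) (Dts : List Transition) (Dstates : ℕ)
         (fr : ℕ → Maybe Bool) (fr-beyond : ∀ i → suc N' ≤ i → fr i ≡ nothing) where

  open FirstPass N' val Dts Dstates fr fr-beyond public

  secondPass-finish : ∀ A ps t → Shows t (blockAt (secondPassBlocks A ps [])) →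
                      ReachesTag (cfg (stateCode (BM bLP2) 2) (cellOf (length (secondPassBlocks A ps [])) j0) t) RUN 0 (cellOf 1 j2)
                                 (λ t′ → Shows t′ (blockAt (simulationBlocks A ps)))
  secondPass-finish A ps t lay = res
    where
      xs = map Unread ps
      TT = lengthAndPrefixCode A ++ blockCodes ps
      mid = map Out TT
      g = blockAt (sentinel ∷ (xs ++ mid))
      K = suc (length xs)
      s1 = seekSecondPass xs mid t lay (secondPass-stop ps) (AllBlocks-map (scanLeftPasses l1) Out TT (λ _ → refl))
      t1 = proj₁ s1
      lay1 : Shows t1 g
      lay1 = Shows-≗ (proj₂ (proj₂ s1)) lay
      e0 : t1 (cellOf K j0) ≡ true
      e0 = trans (lay1 K j0) (cong mark (blockAt-middle xs (Out true) (map Out _)))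
      ta = writeTape fr (cellOf K j0) false t1
      ea : ta (cellOf K j1) ≡ false
      ea = trans (write-elsewhere fr (cellOf K j0) false t1 (cellOf K j1) (λ e → j1≢j0 (proj₂ (cellOf-injective {K} {K} {j1} {j0} e))))
                 (trans (lay1 K j1) (cong flag (blockAt-middle xs (Out true) (map Out _))))
        where j1≢j0 : j1 ≢ j0
              j1≢j0 ()
      tb = writeTape fr (cellOf K j1) false ta
      tc = writeTape fr (cellOf K j0) true tb
      qc : tc ≗ t1
      qc = write-restore fr (cellOf K j0) (cellOf K j1) t1 false false true e0 (cellOf-unfrozen K j0) ea
      stepsC : Star (Step tableMachine fr) (cfg (stateCode C2 0) (cellOf K j0) t1) (cfg (stateCode (BM bC2y) 1) (cellOf (length xs) j2) tc)
      stepsC = tableStep {g = C2} {i = 0} true 0<paramBound e0 refl ◅ tableStep {g = C2f} {i = 0} false 0<paramBound ea refl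
               ◅ tableStep {g = C2x} {i = 0} (tb (cellOf K j0)) 0<paramBound refl refl ◅ ε
      scan : ∀ t' → Shows t' g → ReachesTag (cfg (stateCode (SLa l2) 0) (cellOf (length xs) j0) t') CL 0 (cellOf 0 j0) (λ t'' → t'' ≗ t')
      scan t' l = subst (λ z → ReachesTag (cfg (stateCode (SLa l2) 0) (cellOf z j0) t') CL 0 (cellOf 0 j0) (λ t'' → t'' ≗ t')) (+-identityʳ (length xs))
             (scanLeft l2 (length xs) 0 t' g l
               (λ i i< → not-true (subst (λ z → (scanLeftPasses l2) z ≡ true) (cong (blockAt (xs ++ mid)) (sym (+-identityʳ i)))
                          (blockAt-++-AllBlocks (scanLeftPasses l2) xs mid (AllBlocks-map (scanLeftPasses l2) Unread ps (λ _ → refl)) i i<)))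
               refl)
      fin : ∀ t' → Shows t' g → ReachesTag (cfg (stateCode CL 0) (cellOf 0 j0) t') RUN 0 (cellOf 1 j2) (λ t'' → Shows t'' (blockAt (simulationBlocks A ps)))
      fin t' l = Reaches-map (λ t'' q → Shows-≗ {t' = t''} q layF)
                   ((tB , tableStep {g = CL} {i = 0} (t' (cellOf 0 j0)) 0<paramBound refl refl ◅ tableStep {g = CLf} {i = 0} (tA (cellOf 0 j1)) 0<paramBound refl refl ◅ ε , ≗-refl)
                    ▷ (λ t2 q2 → Reaches-map (λ t3 q3 → ≗-trans {t3} q3 q2) (blindMove bCL 2 (cellOf 0 j2) t2 (small<paramBound (s≤s (s≤s z≤n))))))
        where
          tA = writeTape fr (cellOf 0 j0) true t'
          tB = writeTape fr (cellOf 0 j1) true tA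
          layF : Shows tB (blockAt (simulationBlocks A ps))
          layF = Shows-cong {tB} (λ m → trans (update-twice 0 true true g m) (update-middle [] sentinel leftEnd (xs ++ mid) g (λ _ → refl) m))
                   (Shows-write {tA} 0 j1 true (Shows-write {t'} {g} 0 j0 true l))
      res = (tc , proj₁ (proj₂ s1) ◅◅ stepsC , Shows-≗ qc lay1)
            ▷ (λ t' l → Reaches-map (λ t'' q → Shows-≗ {t' = t''} q l) (blindMove bC2y 1 (cellOf (length xs) j2) t' (small<paramBound (s≤s z≤n))))
            ▷ (λ t' l → Reaches-map (λ t'' q → Shows-≗ {t' = t''} q l) (scan t' l))
            ▷ fin

  simulationBlocks-cong : ∀ {c A ps ps′} → ps ≡ ps′ →
                          ReachesTag c RUN 0 (cellOf 1 j2) (λ t′ → Shows t′ (blockAt (simulationBlocks A ps))) →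
                          ReachesTag c RUN 0 (cellOf 1 j2) (λ t′ → Shows t′ (blockAt (simulationBlocks A ps′)))
  simulationBlocks-cong refl r = r

  secondPass : ∀ A us ps t → Shows t (blockAt (secondPassBlocks A ps us)) →
          ReachesTag (cfg (stateCode (BM bLP2) 2) (cellOf (length (secondPassBlocks A ps us)) j0) t) RUN 0 (cellOf 1 j2) (λ t' → Shows t' (blockAt (simulationBlocks A (ps ++ us))))
  secondPass A [] ps t lay = simulationBlocks-cong {A = A} (sym (LP.++-identityʳ ps)) (secondPass-finish A ps t lay)
  secondPass A (a ∷ us') ps t lay = simulationBlocks-cong {A = A} (LP.++-assoc ps (a ∷ []) us') res
    where
      xs = map Unread ps
      rest = map Read us' ++ map Out (lengthAndPrefixCode A ++ blockCodes ps)
      bsA = sentinel ∷ (xs ++ Unread a ∷ rest)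
      allmid : AllBlocks (scanLeftPasses l1) (Read a ∷ rest)
      allmid = refl , AllBlocks-++ (scanLeftPasses l1) (map Read us') _ (AllBlocks-map (scanLeftPasses l1) Read us' (λ _ → refl)) (AllBlocks-map (scanLeftPasses l1) Out (lengthAndPrefixCode A ++ blockCodes ps) (λ _ → refl))
      allnb : AllBlocks nonBlank rest
      allnb = AllBlocks-++ nonBlank (map Read us') _ (AllBlocks-map nonBlank Read us' (λ _ → refl)) (AllBlocks-nonBlank-Out (lengthAndPrefixCode A ++ blockCodes ps))
      res : ReachesTag (cfg (stateCode (BM bLP2) 2) (cellOf (length (secondPassBlocks A ps (a ∷ us'))) j0) t) RUN 0 (cellOf 1 j2)
                  (λ t' → Shows t' (blockAt (simulationBlocks A ((ps ++ a ∷ []) ++ us'))))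
      res = seekSecondPass xs (Read a ∷ rest) t lay (secondPass-stop ps) allmid
            ▷ (λ t1 q1 → markUnread xs a rest t1 (Shows-≗ {t' = t1} q1 lay))
            ▷ (λ t2 l2 → Reaches-map (λ t' q → Shows-≗ {t' = t'} q l2) (scanToEnd-for a xs (Unread a) rest t2 l2 allnb))
            ▷ (λ t3 l3 → appendBlockCode a bsA t3 (secondPassBlocks-step A ps a us') l3)
            ▷ (λ t4 l4 → secondPass A us' (ps ++ a ∷ []) t4 l4)

module Simulation (N' : ℕ) (val : ℕ → Bool) (Dts : List Transition) (Dstates : ℕ)
         (fr : ℕ → Maybe Bool) (fr-beyond : ∀ i → suc N' ≤ i → fr i ≡ nothing)
         (detD : ∀ {t t'} → t ∈ Dts → t' ∈ Dts → from t ≡ from t' → read t ≡ read t' → t ≡ t')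
         (Dstates-bound : ∀ t → t ∈ Dts → to t < Dstates) where

  open Layout N' val Dts Dstates fr fr-beyond public

  stepRead : ∀ {g i h t g' i' m s h' t₀} {P : Tape → Set} x → i < paramBound → t h ≡ x → δ g i x ≡ just (g' , i' , x , m) →
          t ≗ t₀ → (∀ t' → t' ≗ t₀ → Reaches (cfg (stateCode g' i') (moveHead m h) t') s h' P) →
          Reaches (cfg (stateCode g i) h t) s h' P
  stepRead {h = h} {t = t} x i< rx e q k with k (writeTape fr h x t) (≗-trans (write-current fr h x t rx) q)
  ... | t2 , r , p = t2 , tableStep x i< rx e ◅ r , p

  stepBlind : ∀ {g i h t g' i' m s h' t₀} {P : Tape → Set} → i < paramBound → (∀ x → δ g i x ≡ just (g' , i' , x , m)) →
          t ≗ t₀ → (∀ t' → t' ≗ t₀ → Reaches (cfg (stateCode g' i') (moveHead m h) t') s h' P) →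
          Reaches (cfg (stateCode g i) h t) s h' P
  stepBlind {h = h} {t = t} i< e q k = stepRead (t h) i< refl (e (t h)) q k

  reached : ∀ {s h t t₀} → t ≗ t₀ → Reaches (cfg s h t) s h (λ t' → t' ≗ t₀)
  reached q = _ , ε , q

  -- D's cell k is the datum of block suc k. Block 0 is the only block both marked and flagged;
  -- that is how a left move of D from cell 0 is recognised and turned into staying put.
  Simulates : Tape → Tape → Set
  Simulates t tD = ∃ λ g → Shows t g × mark (g 0) ≡ true × flag (g 0) ≡ true ×
                (∀ k → mark (g (suc k)) ∧ flag (g (suc k)) ≡ false) × (∀ k → datum (g (suc k)) ≡ tD k)

  Simulates-≗ : ∀ {t t' tD} → t' ≗ t → Simulates t tD → Simulates t' tD
  Simulates-≗ q (g , l , a , b , c , d) = g , Shows-≗ q l , a , b , c , d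

  Simulates-write : ∀ h b t tD → Simulates t tD → Simulates (writeTape fr (cellOf (suc h) j2) b t) (writeTape (λ _ → nothing) h b tD)
  Simulates-write h b t tD (g , l , a , bb , c , d) =
    g1 , Shows-write {t} {g} (suc h) j2 b l , a , bb , c1 , d1
    where
      g1 = update (suc h) (writeSlot j2 b (g (suc h))) g
      c1 : ∀ k → mark (g1 (suc k)) ∧ flag (g1 (suc k)) ≡ false
      c1 k with k ≟ h
      ... | yes refl rewrite ≡ᵇ-refl k = lem (g (suc k)) (c k)
        where lem : ∀ x → mark x ∧ flag x ≡ false → mark (writeSlot j2 b x) ∧ flag (writeSlot j2 b x) ≡ false
              lem (block m f v) p = p
      ... | no ne rewrite ≢⇒≡ᵇfalse ne = c k
      d1 : ∀ k → datum (g1 (suc k)) ≡ writeTape (λ _ → nothing) h b tD k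
      d1 k with k ≟ h
      ... | yes refl rewrite ≡ᵇ-refl k = lem (g (suc k))
        where lem : ∀ x → datum (writeSlot j2 b x) ≡ b
              lem (block m f v) = refl
      ... | no ne rewrite ≢⇒≡ᵇfalse ne = d k

  <Dstates⇒<paramBound : ∀ {q} → q < Dstates → q < paramBound
  <Dstates⇒<paramBound p = ≤-trans p (m≤m+n Dstates (N + N + 10))

  ∧true≡false : ∀ {a} → a ∧ true ≡ false → a ≡ false
  ∧true≡false {false} _ = refl

  simulateLeft : ∀ h q1 t g → q1 < paramBound → Shows t g → mark (g 0) ≡ true → flag (g 0) ≡ true → (∀ k → mark (g (suc k)) ∧ flag (g (suc k)) ≡ false) →
         Reaches (cfg (stateCode DL1 q1) (cellOf (suc h) j1) t) (stateCode RUN q1) (cellOf (suc (moveHead L h)) j2) (λ t' → t' ≗ t)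
  simulateLeft zero q1 t g q< lay m0 f0 c =
    stepBlind {g = DL1} {i = q1} q< (λ _ → refl) ≗-refl (λ t2 q2 →
    stepBlind {g = DL2} {i = q1} q< (λ _ → refl) q2 (λ t3 q3 →
    stepBlind {g = DL3} {i = q1} q< (λ _ → refl) q3 (λ t4 q4 →
    stepRead {g = DL4} {i = q1} true q< (trans (q4 _) (trans (lay 0 j1) f0)) refl q4 (λ t5 q5 →
    stepRead {g = DL5} {i = q1} true q< (trans (q5 _) (trans (lay 0 j0) m0)) refl q5 (λ t6 q6 →
    stepBlind {g = DL7} {i = q1} q< (λ _ → refl) q6 (λ t7 q7 →
    stepBlind {g = DL8} {i = q1} q< (λ _ → refl) q7 (λ t8 q8 →
    stepBlind {g = DL9} {i = q1} q< (λ _ → refl) q8 (λ t9 q9 →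
    stepBlind {g = DL10} {i = q1} q< (λ _ → refl) q9 (λ t10 q10 → reached q10)))))))))
  simulateLeft (suc h) q1 t g q< lay m0 f0 c =
    stepBlind {g = DL1} {i = q1} q< (λ _ → refl) ≗-refl (λ t2 q2 →
    stepBlind {g = DL2} {i = q1} q< (λ _ → refl) q2 (λ t3 q3 →
    stepBlind {g = DL3} {i = q1} q< (λ _ → refl) q3 (λ t4 q4 → br (flag (g (suc h))) refl t4 q4)))
    where
      br : ∀ f → flag (g (suc h)) ≡ f → ∀ t4 → t4 ≗ t →
           Reaches (cfg (stateCode DL4 q1) (cellOf (suc h) j1) t4) (stateCode RUN q1) (cellOf (suc h) j2) (λ t' → t' ≗ t)
      br false e t4 q4 = stepRead {g = DL4} {i = q1} false q< (trans (q4 _) (trans (lay (suc h) j1) e)) refl q4 (λ t5 q5 → reached q5)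
      br true e t4 q4 = stepRead {g = DL4} {i = q1} true q< (trans (q4 _) (trans (lay (suc h) j1) e)) refl q4 (λ t5 q5 →
                         stepRead {g = DL5} {i = q1} false q< (trans (q5 _) (trans (lay (suc h) j0) (∧true≡false (subst (λ z → mark (g (suc h)) ∧ z ≡ false) e (c h))))) refl q5 (λ t6 q6 →
                         stepBlind {g = DL6} {i = q1} q< (λ _ → refl) q6 (λ t7 q7 → reached q7)))

  simulateStep : ∀ {q h tD c'} → Step (mkTM Dts) (λ _ → nothing) (cfg q h tD) c' → q < Dstates → ∀ t → Simulates t tD →
            Reaches (cfg (stateCode RUN q) (cellOf (suc h) j2) t) (stateCode RUN (state c')) (cellOf (suc (head c')) j2) (λ t' → Simulates t' (tape c'))
  simulateStep {q} {h} {tD} (step {tr q0 b0 q1 b1 mv} t∈ f r) q< t sim@(g , l , a0 , b0' , c , d) = go mv refl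
    where
      trr = tr q0 b0 q1 b1 mv
      ex : t (cellOf (suc h) j2) ≡ tD h
      ex = trans (l (suc h) j2) (d h)
      lk : lookupTransition Dts q (tD h) ≡ just trr
      lk with lookupTransition-complete Dts q (tD h) trr t∈ f r
      ... | t' , e with lookupTransition-sound Dts q (tD h) t' e
      ... | t'∈ , f' , r' rewrite detD t'∈ t∈ (trans f' (sym f)) (trans r' (sym r)) = e
      t1 = writeTape fr (cellOf (suc h) j2) b1 t
      sim1 : Simulates t1 (writeTape (λ _ → nothing) h b1 tD)
      sim1 = Simulates-write h b1 t tD sim
      s0 : ∀ (m : Move) → mv ≡ m → Step tableMachine fr (cfg (stateCode RUN q) (cellOf (suc h) j2) t) (cfg (stateCode (afterMove m) q1) (moveHead m (cellOf (suc h) j2)) t1)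
      s0 m e = tableStep {g = RUN} {i = q} (tD h) (<Dstates⇒<paramBound q<) ex (trans (cong (λ z → runEntry z (tD h)) lk) (cong (λ z → just (afterMove z , q1 , b1 , z)) e))
      q1< : q1 < paramBound
      q1< = <Dstates⇒<paramBound (Dstates-bound _ t∈)
      go : ∀ m → mv ≡ m → Reaches (cfg (stateCode RUN q) (cellOf (suc h) j2) t) (stateCode RUN q1) (cellOf (suc (moveHead m h)) j2)
                          (λ t' → Simulates t' (writeTape (λ _ → nothing) h b1 tD))
      go R e = Reaches-cons (s0 R e) (Reaches-map (λ t' q' → Simulates-≗ q' sim1) restR)
        where restR : Reaches (cfg (stateCode DR1 q1) (cellOf (suc (suc h)) j0) t1) (stateCode RUN q1) (cellOf (suc (suc h)) j2) (λ t' → t' ≗ t1)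
              restR = stepBlind {g = DR1} {i = q1} q1< (λ _ → refl) ≗-refl (λ t2 q2 →
                        stepBlind {g = DR2} {i = q1} q1< (λ _ → refl) q2 (λ t3 q3 → reached q3))
      go L e = Reaches-cons (s0 L e) (Reaches-map (λ t' q' → Simulates-≗ q' sim1) (simulateLeft h q1 t1 _ q1< (proj₁ (proj₂ sim1)) (proj₁ (proj₂ (proj₂ sim1)))
                    (proj₁ (proj₂ (proj₂ (proj₂ sim1)))) (proj₁ (proj₂ (proj₂ (proj₂ (proj₂ sim1)))))))

  step-state< : ∀ {c c′} → Step (mkTM Dts) (λ _ → nothing) c c′ → state c′ < Dstates
  step-state< (step t∈ _ _) = Dstates-bound _ t∈

  run-state< : ∀ {c cH} → Star (Step (mkTM Dts) (λ _ → nothing)) c cH → state c < Dstates → state cH < Dstates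
  run-state< ε q< = q<
  run-state< (s ◅ ss) _ = run-state< ss (step-state< s)

  simulateRun : ∀ {c cH} → Star (Step (mkTM Dts) (λ _ → nothing)) c cH → state c < Dstates → ∀ t → Simulates t (tape c) →
           Reaches (cfg (stateCode RUN (state c)) (cellOf (suc (head c)) j2) t) (stateCode RUN (state cH)) (cellOf (suc (head cH)) j2) (λ t′ → Simulates t′ (tape cH))
  simulateRun ε q< t sim = t , ε , sim
  simulateRun (s ◅ ss) q< t sim = simulateStep s q< t sim ▷ λ t′ sim′ → simulateRun ss (step-state< s) t′ sim′

  readAnswer : ∀ q h tD t → lookupTransition Dts q (tD h) ≡ nothing → q < Dstates → Simulates t tD →
         Reaches (cfg (stateCode RUN q) (cellOf (suc h) j2) t) (stateCode Q 0) (cellOf 1 j2) (λ t' → t' (cellOf 1 j2) ≡ tD 0)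
  readAnswer q h tD t ln q< (g , lay , m0 , f0 , c , d) =
    Reaches-map (λ t' e → trans (e _) (trans (lay 1 j2) (d 0)))
      (stepRead {g = RUN} {i = q} (tD h) (<Dstates⇒<paramBound q<) (trans (lay (suc h) j2) (d h)) (cong (λ z → runEntry z (tD h)) ln) ≗-refl (λ t2 q2 →
       stepBlind {g = BM bH} {i = 0} 0<paramBound (λ _ → refl) q2 (λ t3 q3 →
         Reaches-map (λ t' q' → ≗-trans q' q3)
           (subst (λ z → Reaches (cfg (stateCode (SLa l3) 0) (cellOf z j0) t3) (stateCode (scanLeftNext l3) (scanLeftNextParam l3)) (cellOf 0 j0) (λ t' → t' ≗ t3)) (+-identityʳ (suc h))
             (scanLeft l3 (suc h) 0 t3 g (Shows-≗ q3 lay)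
                (λ i i< → subst (λ z → scanLeftStop l3 (mark (g z)) (flag (g z)) ≡ false) (cong suc (sym (+-identityʳ i))) (c i))
                (cong₂ _∧_ m0 f0)))
         ▷ (λ t4 q4 → Reaches-map (λ t' q' → ≗-trans q' q4) (blindMove bPR 4 (cellOf 0 j0) t4 (small<paramBound (s≤s (s≤s (s≤s (s≤s z≤n))))))))))

  writeValuation-cell : ∀ j t → Respects fr t → (∀ i b → fr i ≡ just b → val i ≡ b) → writeTape fr j (val j) t j ≡ val j
  writeValuation-cell j t r vok with fr j in e
  ... | nothing rewrite ≡ᵇ-refl j = refl
  ... | just b rewrite ≡ᵇ-refl j = trans (r j b e) (sym (vok j b e))

  writeValuation : ∀ j t → j < N → Respects fr t → (∀ i b → fr i ≡ just b → val i ≡ b) → (∀ i → j < i → i < N → t i ≡ val i) →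
       Reaches (cfg (stateCode WV j) j t) (stateCode DONE 0) 0 (λ t' → Respects fr t' × (∀ i → i < N → t' i ≡ val i))
  writeValuation zero t j< r vok good = _ , tableStep {g = WV} {i = 0} (t 0) 0<paramBound refl refl ◅ ε , write-respects fr 0 (val 0) t r , fin
    where fin : ∀ i → i < N → writeTape fr 0 (val 0) t i ≡ val i
          fin zero _ = writeValuation-cell 0 t r vok
          fin (suc i) i< = trans (write-elsewhere fr 0 (val 0) t (suc i) (λ ())) (good (suc i) (s≤s z≤n) i<)
  writeValuation (suc j) t j< r vok good with writeValuation j (writeTape fr (suc j) (val (suc j)) t) (<⇒≤ j<) (write-respects fr (suc j) _ t r) vok good'
    where good' : ∀ i → j < i → i < N → writeTape fr (suc j) (val (suc j)) t i ≡ val i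
          good' i j<i i< with i ≟ suc j
          ... | yes refl = writeValuation-cell (suc j) t r vok
          ... | no ne = trans (write-elsewhere fr (suc j) _ t i ne) (good i (≤∧≢⇒< j<i (λ e → ne (sym e))) i<)
  ... | t' , run , p = t' , tableStep {g = WV} {i = suc j} (t (suc j)) (≤-trans j< (≤-trans (m≤m+n N (N + 10)) (≤-trans (≤-reflexive (sym (+-assoc N N 10))) (m≤n+m _ Dstates)))) refl refl ◅ run , p

module SelfEncoding (N' : ℕ) (val : ℕ → Bool) (Dts : List Transition) (Dstates : ℕ)
         (fr : ℕ → Maybe Bool) (fr-beyond : ∀ i → suc N' ≤ i → fr i ≡ nothing) where

  open FirstPass N' val Dts Dstates fr fr-beyond public

  selfInput : List Bool → List Bool
  selfInput A = replicate N false ++ flatten (sentinel ∷ map Unread A)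

  unaryTriples-flatten : ∀ A → replicate (length (flatten (map Unread A))) true ≡ unaryTriples A
  unaryTriples-flatten [] = refl
  unaryTriples-flatten (a ∷ A) = cong (λ z → true ∷ true ∷ true ∷ z) (unaryTriples-flatten A)

  blockCodes-flatten : ∀ A → encNats (map bitℕ (flatten (map Unread A))) ≡ blockCodes A
  blockCodes-flatten [] = refl
  blockCodes-flatten (a ∷ A) = trans (cong encNats (LP.map-++ bitℕ (false ∷ true ∷ a ∷ []) (flatten (map Unread A))))
                        (trans (encNats-++ (map bitℕ (false ∷ true ∷ a ∷ [])) (map bitℕ (flatten (map Unread A))))
                               (cong (blockCode a ++_) (blockCodes-flatten A)))

  encode-selfInput : ∀ A → encNats (length (selfInput A) ∷ map bitℕ (selfInput A)) ≡ lengthAndPrefixCode A ++ blockCodes A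
  encode-selfInput A = begin
      (replicate (suc (length d)) true ++ false ∷ []) ++ encNats (map bitℕ d)
        ≡⟨ LP.++-assoc (replicate (suc (length d)) true) (false ∷ []) (encNats (map bitℕ d)) ⟩
      replicate (suc (length d)) true ++ (false ∷ encNats (map bitℕ d))
        ≡⟨ cong₂ _++_ repEq (cong (false ∷_) encModel-M) ⟩
      (payload w0 ++ unaryTriples A) ++ (false ∷ (E0 ++ blockCodes A))
        ≡⟨ sym (LP.++-assoc (payload w0 ++ unaryTriples A) (payload w2) (blockCodes A)) ⟩
      lengthAndPrefixCode A ++ blockCodes A
      ∎
    where
      open ≡-Reasoning
      d = selfInput A
      X = flatten (map Unread A)
      fft : List Bool
      fft = false ∷ false ∷ true ∷ []
      E0 = encNats (map bitℕ (replicate N false ++ fft))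
      lenD : length d ≡ N + (3 + length X)
      lenD = trans (LP.length-++ (replicate N false)) (cong (_+ (3 + length X)) (LP.length-replicate N))
      repEq : replicate (suc (length d)) true ≡ payload w0 ++ unaryTriples A
      repEq = cong (true ∷_) (trans (cong (λ z → replicate z true) lenD)
                (trans (replicate-+ N (3 + length X) true)
                  (trans (cong (λ z → replicate N true ++ (true ∷ true ∷ true ∷ z)) (unaryTriples-flatten A))
                         (sym (LP.++-assoc (replicate N true) (true ∷ true ∷ true ∷ []) (unaryTriples A))))))
      encModel-M : encNats (map bitℕ d) ≡ E0 ++ blockCodes A
      encModel-M = trans (cong (λ z → encNats (map bitℕ z)) (sym (LP.++-assoc (replicate N false) fft X)))
               (trans (cong encNats (LP.map-++ bitℕ (replicate N false ++ fft) X))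
                 (trans (encNats-++ (map bitℕ (replicate N false ++ fft)) (map bitℕ X)) (cong (E0 ++_) (blockCodes-flatten A))))

  encModel-selfInput : ∀ ts → let A = encNats (length ts ∷ concatMap transℕ ts) in
                encModel (model (mkTM ts) (selfInput A)) ≡ A ++ (lengthAndPrefixCode A ++ blockCodes A)
  encModel-selfInput ts = trans (encNats-++ (length ts ∷ concatMap transℕ ts) (length (selfInput A) ∷ map bitℕ (selfInput A)))
                     (cong (A ++_) (encode-selfInput A))
    where A = encNats (length ts ∷ concatMap transℕ ts)

module Diagonal (α : Lint) (β : Formula) (v : Valuation) (ev : eval v (⌜ α ⌝ ∧f β) ≡ true) (D : TM)
           (detD : Deterministic D) where

  N' : ℕ
  N' = literalBound (lits α) + varBound β

  Dts : List Transition
  Dts = transitions D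

  Dstates : ℕ
  Dstates = suc (sumTargets Dts)

  fr : ℕ → Maybe Bool
  fr = forced (lits α)

  fr-beyond : ∀ i → suc N' ≤ i → fr i ≡ nothing
  fr-beyond i le = forced-beyond (lits α) i (≤-trans (m≤m+n (literalBound (lits α)) (varBound β)) (≤-trans (n≤1+n N') le))

  Dstates-bound : ∀ t → t ∈ Dts → to t < Dstates
  Dstates-bound t t∈ = s≤s (to≤sumTargets Dts t t∈)

  open SecondPass N' v Dts Dstates fr fr-beyond
  module S = Simulation N' v Dts Dstates fr fr-beyond detD Dstates-bound
  module E = SelfEncoding N' v Dts Dstates fr fr-beyond

  P : TM
  P = tableMachine

  A : List Bool
  A = encNats (length (transitions P) ∷ concatMap transℕ (transitions P))

  d : List Bool
  d = E.selfInput A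

  M : Model
  M = model P d

  inputBlocks : List Block
  inputBlocks = sentinel ∷ map Unread A

  initialTape : Tape
  initialTape = interveneTape (lits α) (listTape d)

  N≤paramBound : N ≤ paramBound
  N≤paramBound = ≤-trans (m≤m+n N (N + 10)) (≤-trans (≤-reflexive (sym (+-assoc N N 10))) (m≤n+m _ Dstates))

  walkPrefix : ∀ dd i t → suc (i + dd) ≡ N → Reaches (cfg (stateCode W i) i t) (stateCode (BM bA) 2) N (λ t' → t' ≗ t)
  walkPrefix zero i t e = subst (λ z → Reaches (cfg (stateCode W i) i t) (stateCode (BM bA) 2) z (λ t' → t' ≗ t)) e1
      (_ , tableStep {g = W} {i = i} (t i) i<B refl (cong (λ z → just ((if z then BM bA else W) , (if z then 2 else suc i) , t i , R)) cT) ◅ ε ,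
       write-current fr i (t i) t refl)
    where
      e1 : suc i ≡ N
      e1 = trans (cong suc (sym (+-identityʳ i))) e
      cT : (suc i ≡ᵇ N) ≡ true
      cT = ≡⇒≡ᵇ-true (suc i) N e1
      i<B : i < paramBound
      i<B = ≤-trans (≤-reflexive e1) N≤paramBound
  walkPrefix (suc dd) i t e =
    Reaches-map (λ t' q → ≗-trans q (write-current fr i (t i) t refl))
      (Reaches-cons (tableStep {g = W} {i = i} (t i) i<B refl (cong (λ z → just ((if z then BM bA else W) , (if z then 2 else suc i) , t i , R)) cF))
           (walkPrefix dd (suc i) (writeTape fr i (t i) t) (trans (cong suc (sym (+-suc i dd))) e)))
    where
      i<B : i < paramBound
      i<B = ≤-trans (≤-trans (s≤s (m≤m+n i (suc dd))) (≤-reflexive e)) N≤paramBound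
      cF : (suc i ≡ᵇ N) ≡ false
      cF = ≢⇒≡ᵇfalse (λ e' → <-irrefl (suc-injective (trans e' (sym e))) (m<m+n i (s≤s z≤n)))

  initial-shows : Shows initialTape (blockAt inputBlocks)
  initial-shows k j = trans (intervene-free (lits α) (listTape d) (cellOf k j) (fr-beyond (cellOf k j) (N≤cellOf k j)))
               (trans (listTape-replicate N (flatten inputBlocks) (slotIndex j + k * 3)) (listTape-flatten inputBlocks k j))

  n : ℕ
  n = length (map Unread A)

  inputBlocks-extended : inputBlocks ++ map Out (payload w0) ≡ firstPassBlocks [] A
  inputBlocks-extended = cong (λ z → sentinel ∷ (map Unread A ++ map Out z)) (sym (LP.++-identityʳ (payload w0)))

  firstPassDone-secondPass : firstPassDone A ≡ secondPassBlocks A [] A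
  firstPassDone-secondPass = cong (λ z → sentinel ∷ (map Read A ++ map Out z)) (sym (LP.++-identityʳ (lengthAndPrefixCode A)))

  reach-simulation : Reaches (cfg 0 0 initialTape) (stateCode RUN 0) (cellOf 1 j2) (λ t' → Shows t' (blockAt (simulationBlocks A A)))
  reach-simulation = walkPrefix N' 0 initialTape refl
    ▷ (λ t1 q1 → Reaches-map (λ t' q → ≗-trans q q1) (blindMove bA 2 N t1 (small<paramBound (s≤s (s≤s z≤n)))))
    ▷ (λ t2 q2 → Reaches-block-cong (+-comm n 1) (Reaches-map (λ t' q → Shows-≗ {t' = t'} q (Shows-≗ q2 initial-shows))
         (scanRight r0 n 1 t2 (blockAt inputBlocks) (Shows-≗ q2 initial-shows)
           (λ i i< → subst (λ z → nonBlank z ≡ true) (sym (cong (blockAt inputBlocks) (+-comm i 1)))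
                       (blockAt-AllBlocks nonBlank (map Unread A) (AllBlocks-map nonBlank Unread A (λ _ → refl)) i i<))
           (cong mark end) (cong flag end))))
    ▷ (λ t3 l3 → appendPayload w0 inputBlocks t3 inputBlocks-extended l3)
    ▷ (λ t4 l4 → firstPass A [] t4 l4)
    ▷ (λ t5 l5 → subst (λ z → Reaches (cfg (stateCode (BM bLP2) 2) (cellOf z j0) t5) (stateCode RUN 0) (cellOf 1 j2) (λ t' → Shows t' (blockAt (simulationBlocks A A))))
                       (sym (cong length firstPassDone-secondPass))
                       (secondPass A A [] t5 (Shows-cong {t5} (λ m → cong (λ z → blockAt z m) firstPassDone-secondPass) l5)))
    where
      end : blockAt inputBlocks (n + 1) ≡ blank
      end = trans (cong (blockAt inputBlocks) (+-comm n 1)) (trans (cong (blockAt (map Unread A)) (sym (+-identityʳ n))) (blockAt-beyond (map Unread A) 0))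

  datum-Unread : ∀ xs → map datum (map Unread xs) ≡ xs
  datum-Unread [] = refl
  datum-Unread (x ∷ xs) = cong (x ∷_) (datum-Unread xs)

  datum-Out : ∀ xs → map datum (map Out xs) ≡ xs
  datum-Out [] = refl
  datum-Out (x ∷ xs) = cong (x ∷_) (datum-Out xs)

  X : List Bool
  X = lengthAndPrefixCode A ++ blockCodes A

  encModel-M : encModel M ≡ A ++ X
  encModel-M = E.encModel-selfInput (transitions P)

  simulation-start : ∀ t → Shows t (blockAt (simulationBlocks A A)) → S.Simulates t (listTape (encModel M))
  simulation-start t l = blockAt (simulationBlocks A A) , l , refl , refl ,
    (λ k → not-true (blockAt-all (λ b → not (mark b ∧ flag b)) (map Unread A ++ map Out X)
                    (AllBlocks-++ _ (map Unread A) (map Out X) (AllBlocks-map _ Unread A (λ _ → refl)) (AllBlocks-map _ Out X (λ _ → refl))) refl k)) ,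
    (λ k → trans (datum-blockAt (map Unread A ++ map Out X) k)
             (cong (λ z → listTape z k) (trans (LP.map-++ datum (map Unread A) (map Out X))
               (trans (cong₂ _++_ (datum-Unread A) (datum-Out X)) (sym encModel-M)))))

  loop-forever : ∀ {c c′} → Star (Step tableMachine fr) c c′ → state c ≡ stateCode LOOP 0 → state c′ ≡ stateCode LOOP 0
  loop-forever ε e = e
  loop-forever {c} (s ◅ ss) e with table-functional s (table-step {c = c} {g = LOOP} {i = 0} {b = tape c (head c)} 0<paramBound e refl refl)
  ... | refl = loop-forever ss refl

  initial-respects : Respects fr initialTape
  initial-respects i b e = intervene-forced (lits α) (listTape d) i b e

  v-respects : ∀ i b → fr i ≡ just b → v i ≡ b
  v-respects i b e = forced-agrees v (lits α) i b (∧-elimˡ ev) e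

  module _ {cH : Config} (runD : Star (Step D (λ _ → nothing)) (cfg 0 0 (listTape (encModel M))) cH)
           (haltD : Halted D cH) where

    reach-simulated-halt : Reaches (cfg 0 0 initialTape) (stateCode RUN (state cH)) (cellOf (suc (head cH)) j2)
                                   (λ t′ → S.Simulates t′ (tape cH))
    reach-simulated-halt = proj₁ sr , proj₁ (proj₂ reach-simulation) ◅◅ proj₁ (proj₂ sr) , proj₂ (proj₂ sr)
      where sr = S.simulateRun runD (s≤s z≤n) (proj₁ reach-simulation) (simulation-start (proj₁ reach-simulation) (proj₂ (proj₂ reach-simulation)))

    reach-answer : Reaches (cfg 0 0 initialTape) (stateCode Q 0) (cellOf 1 j2) (λ t′ → t′ (cellOf 1 j2) ≡ tape cH 0)
    reach-answer = reach-simulated-halt ▷ λ t sim →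
      S.readAnswer (state cH) (head cH) (tape cH) t (lookupTransition-none Dts _ _ (λ t∈ p → haltD t∈ p))
                   (S.run-state< runD (s≤s z≤n)) sim

    yes⇒unsatisfied : tape cH 0 ≡ true → ¬ M ⊨⟨ α ⟩ β
    yes⇒unsatisfied said-yes (c , runM , haltM , _) =
      halted⇒¬step (table-step {fr = fr} {c = c} {g = LOOP} {i = 0} {b = tape c (head c)} 0<paramBound
                      (loop-forever (functional-run-prefix table-functional runM haltM toLoop) refl) refl refl) haltM
      where
        toLoop = proj₁ (proj₂ reach-answer) ◅◅
                 (tableStep {g = Q} {i = 0} true 0<paramBound (trans (proj₂ (proj₂ reach-answer)) said-yes) refl ◅ ε)

    reach-valuation-writer : tape cH 0 ≡ false → Reaches (cfg 0 0 initialTape) (stateCode WV N') N' (λ _ → ⊤)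
    reach-valuation-writer said-no = reach-answer ▷ λ t answer →
      Reaches-map (λ _ _ → tt)
        (Reaches-cons (tableStep {g = Q} {i = 0} false 0<paramBound (trans answer said-no) refl)
                      (blindMove bPL 4 (cellOf 1 j1) (writeTape fr (cellOf 1 j2) false t)
                                 (small<paramBound (s≤s (s≤s (s≤s (s≤s z≤n)))))))

    no⇒satisfied : tape cH 0 ≡ false → M ⊨⟨ α ⟩ β
    no⇒satisfied said-no = satisfied (reach-valuation-writer said-no)
      where
      written : ∀ {t} → Star (Step tableMachine fr) (cfg 0 0 initialTape) (cfg (stateCode WV N') N' t) →
                Reaches (cfg (stateCode WV N') N' t) (stateCode DONE 0) 0 (λ t′ → Respects fr t′ × (∀ i → i < N → t′ i ≡ v i)) →
                M ⊨⟨ α ⟩ β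
      written run (tf , run′ , _ , agrees) =
        cfg (stateCode DONE 0) 0 tf , run ◅◅ run′ ,
        table-halted {c = cfg (stateCode DONE 0) 0 tf} {g = DONE} {i = 0} refl (λ _ → refl) ,
        trans (eval-cong tf v β (λ i i< → agrees i (≤-trans i< (≤-trans (m≤n+m (varBound β) (literalBound (lits α))) (n≤1+n N')))))
              (∧-elimʳ {eval v ⌜ α ⌝} ev)

      satisfied : Reaches (cfg 0 0 initialTape) (stateCode WV N') N' (λ _ → ⊤) → M ⊨⟨ α ⟩ β
      satisfied (t , run , _) =
        written run (S.writeValuation N' t ≤-refl (run-respects run initial-respects) v-respects
                                      (λ i N′<i i<N → ⊥-elim (<⇒≱ i<N N′<i)))

  ¬decides : ¬ DecidesModels D (λ M → M ⊨⟨ α ⟩ β)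
  ¬decides dec = refuted (dec M)
    where
    refuted : ∃ (λ cH → Star (Step D (λ _ → nothing)) (cfg 0 0 (listTape (encModel M))) cH × Halted D cH ×
                        (tape cH 0 ≡ true ⇔ M ⊨⟨ α ⟩ β)) → ⊥
    refuted (cH , runD , haltD , answer) = by-answer (tape cH 0) refl
      where
      by-answer : ∀ b → tape cH 0 ≡ b → ⊥
      by-answer true said-yes = yes⇒unsatisfied runD haltD said-yes (Equivalence.to answer said-yes)
      by-answer false said-no = true≢false (trans (sym (Equivalence.from answer (no⇒satisfied runD haltD said-no))) said-no)
        where true≢false : true ≢ false
              true≢false ()

proposition1 : (α : Lint) (β : Formula) → Consistent (⌜ α ⌝ ∧f β) →
    ¬ TuringDecidable (λ M → M ⊨⟨ α ⟩ β)
proposition1 α β (v , ev) (D , detD , dec) = Diagonal.¬decides α β v ev D detD dec
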